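{- For all positive integers $n$ and $k$, there is a bijection between the set of $k\times k$ matrices in $\mathrm{Int}(n)$ that are (upper) bidiagonal and the set of order-consecutive set partitions of $[n]$ into $k$ parts.
   Context: $\mathrm{Int}(n)$ is the set of upper triangular square matrices with non-negative integer entries summing to $n$ such that every row and column has a non-zero entry. A square matrix $A$ is bidiagonal if $A_{i,j}=0$ whenever $j\notin\{i,i+1\}$. A set partition of $[n]=\{1,\dots,n\}$ into nonempty parts $P_1,\dots,P_k$ is order-consecutive if the parts can be ordered as $P_{\pi_1},\dots,P_{\pi_k}$ (for some permutation $\pi$ of $[k]$) such that for each $j\in[k]$ the union $\bigcup_{i=1}^{j}P_{\pi_i}$ is an interval of consecutive integers. -}

module Defs where

open import Level using (0ℓ)
open import Data.Nat as ℕ using (ℕ; suc)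
open import Data.Fin using (Fin; toℕ)
open import Data.Fin.Permutation using (Permutation′; _⟨$⟩ʳ_; _⟨$⟩ˡ_)
open import Data.Vec using (tabulate; sum)
open import Data.Product using (Σ; ∃; _×_; _,_; proj₁)
open import Relation.Binary.PropositionalEquality using (_≡_; _≢_; refl; sym; trans)
open import Relation.Binary.Bundles using (Setoid)
open import Function.Bundles using (_⇔_; mk⇔; Equivalence)

Mat : ℕ → Set
Mat k = Fin k → Fin k → ℕ

entrySum : ∀ {k} → Mat k → ℕ
entrySum {k} M = sum (tabulate (λ i → sum (tabulate (λ j → M i j))))

UpperTriangular : ∀ {k} → Mat k → Set
UpperTriangular M = ∀ i j → toℕ j ℕ.< toℕ i → M i j ≡ 0

InInt : (n : ℕ) → ∀ {k} → Mat k → Set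
InInt n M =
  UpperTriangular M × entrySum M ≡ n ×
  (∀ i → ∃ λ j → M i j ≢ 0) × (∀ j → ∃ λ i → M i j ≢ 0)

Bidiagonal : ∀ {k} → Mat k → Set
Bidiagonal M = ∀ i j → toℕ j ≢ toℕ i → toℕ j ≢ suc (toℕ i) → M i j ≡ 0

BidiagInt : ℕ → ℕ → Setoid 0ℓ 0ℓ
BidiagInt n k = record
  { Carrier = Σ (Mat k) (λ M → InInt n M × Bidiagonal M)
  ; _≈_ = λ A B → ∀ i j → proj₁ A i j ≡ proj₁ B i j
  ; isEquivalence = record
    { refl = λ i j → refl
    ; sym = λ p i j → sym (p i j)
    ; trans = λ p q i j → trans (p i j) (q i j) } }

-- Set partitions of [n] into k (nonempty) parts are encoded by surjections
-- f : Fin n → Fin k (block b is f⁻¹(b)); two surjections encode the same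
-- partition iff they have the same kernel (i.e. differ by relabelling the blocks).
SurjectiveMap : ∀ {n k} → (Fin n → Fin k) → Set
SurjectiveMap f = ∀ b → ∃ λ x → f x ≡ b

-- Order-consecutive: there is an ordering π of the blocks such that for each j,
-- the union of blocks π 0, …, π j is an interval {a, a+1, …, b} of [n].
OrderConsecutive : ∀ {n k} → (Fin n → Fin k) → Set
OrderConsecutive {n} {k} f =
  Σ (Permutation′ k) λ π → ∀ (j : Fin k) → Σ (Fin n) λ a → Σ (Fin n) λ b →
    ∀ (x : Fin n) →
      ((Σ (Fin k) λ i → toℕ i ℕ.≤ toℕ j × f x ≡ π ⟨$⟩ʳ i)
        ⇔ (toℕ a ℕ.≤ toℕ x × toℕ x ℕ.≤ toℕ b))

SamePartition : ∀ {n k} → (Fin n → Fin k) → (Fin n → Fin k) → Set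
SamePartition f g = ∀ x y → (f x ≡ f y) ⇔ (g x ≡ g y)

OCPartition : ℕ → ℕ → Setoid 0ℓ 0ℓ
OCPartition n k = record
  { Carrier = Σ (Fin n → Fin k) (λ f → SurjectiveMap f × OrderConsecutive f)
  ; _≈_ = λ A B → SamePartition (proj₁ A) (proj₁ B)
  ; isEquivalence = record
    { refl = λ x y → mk⇔ (λ e → e) (λ e → e)
    ; sym = λ p x y → mk⇔ (Equivalence.from (p x y)) (Equivalence.to (p x y))
    ; trans = λ p q x y → mk⇔ (λ e → Equivalence.to (q x y) (Equivalence.to (p x y) e))
                                (λ e → Equivalence.from (p x y) (Equivalence.from (q x y) e)) } }

-- A bidiagonal matrix in Int(n) with diagonal d₀, …, d_{k-1} and superdiagonal
-- e₀, …, e_{k-2} is read as a nest of intervals: a core of d_{k-1} cells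
-- (block 0) inside rings, ring i + 1 having d_i cells on its left and e_i on its
-- right (block i + 1). Laying it out on [0, n) gives an order-consecutive
-- partition, whose prefix unions are the nested intervals, and every
-- order-consecutive partition with a chosen block order arises this way. The
-- order is not unique: a ring without left part may be swapped with an inner
-- ring without right part (or with the core). The row and column conditions of
-- Int(n) say exactly that no such swap is possible, and such canonical nests are
-- determined by their partition: the outer ring is recovered from the blocks of
-- the first and last positions and the runs at both ends, and one recurses
-- inside. Swapping towards canonical form shows that every partition is reached.

module Submission where

open import Defs
open import Data.Nat using (ℕ; zero; suc; _+_; _∸_; _≤_; _<_; z≤n; s≤s; _<?_; _≤?_; _≟_)
open import Data.Nat.Properties
open import Data.Nat.Tactic.RingSolver using (solve-∀)
open import Data.Fin using (Fin; toℕ; fromℕ<) renaming (zero to fzero; suc to fsuc)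
open import Data.Fin.Properties using (toℕ-fromℕ<; fromℕ<-toℕ; toℕ<n; toℕ-injective)
open import Data.Fin.Permutation using (_⟨$⟩ʳ_; _⟨$⟩ˡ_; inverseʳ; inverseˡ)
import Data.Fin.Permutation as Permutation
open import Data.Vec using (tabulate; sum)
open import Data.Product using (Σ; ∃; _×_; _,_; proj₁; proj₂)
open import Data.Sum using (_⊎_; inj₁; inj₂)
open import Data.Empty using (⊥; ⊥-elim)
open import Relation.Nullary using (¬_; yes; no)
open import Relation.Nullary.Decidable using (toSum)
open import Relation.Binary.PropositionalEquality
open import Relation.Binary.Definitions using (tri<; tri≈; tri>)
open import Function using (_∘_)
open import Function.Bundles using (Bijection; _⇔_; mk⇔; Equivalence)
import Function.Properties.Equivalence as ⇔

-- A nest of depth m describes an ordered order-consecutive partition of an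
-- interval: a core interval (block 0) and m rings around it, the ring of
-- depth j + 1 adding l cells on the left and r cells on the right (block j + 1).
data Nest : ℕ → Set where
  core : ℕ → Nest 0
  ring : ∀ {m} → ℕ → ℕ → Nest m → Nest (suc m)

width : ∀ {m} → Nest m → ℕ
width (core s)     = s
width (ring l r c) = l + width c + r

label : ∀ {m} → Nest m → ℕ → ℕ → ℕ
label (core s) lo x = 0
label {suc m} (ring l r c) lo x with x <? lo + l
... | yes _ = suc m
... | no _ with x <? lo + l + width c
...   | yes _ = label c (lo + l) x
...   | no _  = suc m

Proper : ∀ {m} → Nest m → Set
Proper (core s)     = 1 ≤ s
Proper (ring l r c) = 1 ≤ l + r × Proper c

OpensRight : ∀ {m} → Nest m → Set
OpensRight (core _)     = ⊥
OpensRight (ring l r c) = 1 ≤ r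

-- A ring without left part commutes with an inner ring without right part
-- (or with the core) without changing the partition; canonical nests rule
-- this out, which makes the order of the blocks recoverable.
Canonical : ∀ {m} → Nest m → Set
Canonical (core s)     = 1 ≤ s
Canonical (ring l r c) = 1 ≤ l + r × Canonical c × (l ≡ 0 → OpensRight c)

Canonical⇒Proper : ∀ {m} (c : Nest m) → Canonical c → Proper c
Canonical⇒Proper (core s)     p           = p
Canonical⇒Proper (ring l r c) (p , q , _) = p , Canonical⇒Proper c q

width-pos : ∀ {m} (c : Nest m) → Proper c → 1 ≤ width c
width-pos (core s)     p       = p
width-pos (ring l r c) (_ , p) = ≤-trans (width-pos c p) (≤-trans (m≤n+m _ l) (m≤m+n _ r))

label≤depth : ∀ {m} (c : Nest m) lo x → label c lo x ≤ m
label≤depth (core s) lo x = z≤n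
label≤depth {suc m} (ring l r c) lo x with x <? lo + l
... | yes _ = ≤-refl
... | no _ with x <? lo + l + width c
...   | yes _ = m≤n⇒m≤1+n (label≤depth c (lo + l) x)
...   | no _  = ≤-refl

label≢outer : ∀ {m} (c : Nest m) lo x → label c lo x ≢ suc m
label≢outer c lo x e = <-irrefl e (s≤s (label≤depth c lo x))

module _ {m} (l r : ℕ) (c : Nest m) (lo x : ℕ) where

  label-left : x < lo + l → label (ring l r c) lo x ≡ suc m
  label-left p with x <? lo + l
  ... | yes _ = refl
  ... | no ¬p = ⊥-elim (¬p p)

  label-middle : lo + l ≤ x → x < lo + l + width c → label (ring l r c) lo x ≡ label c (lo + l) x
  label-middle p q with x <? lo + l
  ... | yes p' = ⊥-elim (<⇒≱ p' p)
  ... | no _ with x <? lo + l + width c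
  ...   | yes _ = refl
  ...   | no ¬q = ⊥-elim (¬q q)

  label-right : lo + l + width c ≤ x → label (ring l r c) lo x ≡ suc m
  label-right p with x <? lo + l
  ... | yes _ = refl
  ... | no _ with x <? lo + l + width c
  ...   | yes q = ⊥-elim (<⇒≱ q p)
  ...   | no _  = refl

label-noLeft : ∀ {m} r (c : Nest m) lo x → lo ≤ x → x < lo + width c → label (ring 0 r c) lo x ≡ label c lo x
label-noLeft r c lo x p q = begin
  label (ring 0 r c) lo x ≡⟨ label-middle 0 r c lo x (subst (_≤ x) (sym (+-identityʳ lo)) p)
                                                     (subst (λ t → x < t + width c) (sym (+-identityʳ lo)) q) ⟩
  label c (lo + 0) x      ≡⟨ cong (λ t → label c t x) (+-identityʳ lo) ⟩
  label c lo x            ∎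
  where open ≡-Reasoning

<⊎≥ : ∀ x a → x < a ⊎ a ≤ x
<⊎≥ x a with x <? a
... | yes p = inj₁ p
... | no ¬p = inj₂ (≮⇒≥ ¬p)

interval-trichotomy : ∀ a b x → x < a ⊎ (a ≤ x × x < b) ⊎ b ≤ x
interval-trichotomy a b x with <⊎≥ x a
... | inj₁ p = inj₁ p
... | inj₂ p with <⊎≥ x b
...   | inj₁ q = inj₂ (inj₁ (p , q))
...   | inj₂ q = inj₂ (inj₂ q)

SameBlocksOn : (ℕ → ℕ) → (ℕ → ℕ) → ℕ → ℕ → Set
SameBlocksOn g h lo hi = ∀ x y → lo ≤ x → x < hi → lo ≤ y → y < hi →
  (g x ≡ g y → h x ≡ h y) × (h x ≡ h y → g x ≡ g y)

sameBlocks-refl : ∀ g lo hi → SameBlocksOn g g lo hi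
sameBlocks-refl g lo hi x y _ _ _ _ = (λ e → e) , (λ e → e)

sameBlocks-sym : ∀ {g h lo hi} → SameBlocksOn g h lo hi → SameBlocksOn h g lo hi
sameBlocks-sym k x y a b c d = proj₂ (k x y a b c d) , proj₁ (k x y a b c d)

sameBlocks-trans : ∀ {g h i lo hi} → SameBlocksOn g h lo hi → SameBlocksOn h i lo hi → SameBlocksOn g i lo hi
sameBlocks-trans k₁ k₂ x y a b c d =
  (λ e → proj₁ (k₂ x y a b c d) (proj₁ (k₁ x y a b c d) e)) ,
  (λ e → proj₂ (k₁ x y a b c d) (proj₂ (k₂ x y a b c d) e))

sameBlocks-relabel : ∀ {g h : ℕ → ℕ} {lo hi} (φ : ℕ → ℕ) →
  (∀ x → lo ≤ x → x < hi → h x ≡ φ (g x)) → (∀ a b → φ a ≡ φ b → a ≡ b) → SameBlocksOn g h lo hi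
sameBlocks-relabel φ h≡φg φ-inj x y a b c d =
  (λ e → trans (h≡φg x a b) (trans (cong φ e) (sym (h≡φg y c d)))) ,
  (λ e → φ-inj _ _ (trans (sym (h≡φg x a b)) (trans e (h≡φg y c d))))

module _ {m} (l r : ℕ) (c c′ : Nest m) (lo : ℕ) (w≡w′ : width c ≡ width c′) where

  private
    Position : ℕ → Set
    Position x = (label (ring l r c) lo x ≡ suc m × label (ring l r c′) lo x ≡ suc m) ⊎
                 (lo + l ≤ x × x < lo + l + width c ×
                  label (ring l r c) lo x ≡ label c (lo + l) x × label (ring l r c′) lo x ≡ label c′ (lo + l) x)

    position : ∀ x → Position x
    position x with interval-trichotomy (lo + l) (lo + l + width c) x
    ... | inj₁ p = inj₁ (label-left l r c lo x p , label-left l r c′ lo x p)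
    ... | inj₂ (inj₁ (p , q)) =
      inj₂ (p , q , label-middle l r c lo x p q ,
            label-middle l r c′ lo x p (subst (λ w → x < lo + l + w) w≡w′ q))
    ... | inj₂ (inj₂ p) =
      inj₁ (label-right l r c lo x p , label-right l r c′ lo x (subst (λ w → lo + l + w ≤ x) w≡w′ p))

  sameBlocks-ring : SameBlocksOn (label c (lo + l)) (label c′ (lo + l)) (lo + l) (lo + l + width c) →
    SameBlocksOn (label (ring l r c) lo) (label (ring l r c′) lo) lo (lo + width (ring l r c))
  sameBlocks-ring k x y _ _ _ _ with position x | position y
  ... | inj₁ (a , b) | inj₁ (a′ , b′) = (λ _ → trans b (sym b′)) , (λ _ → trans a (sym a′))
  ... | inj₁ (a , b) | inj₂ (_ , _ , a′ , b′) =
    (λ e → ⊥-elim (label≢outer c (lo + l) y (sym (trans (sym a) (trans e a′))))) ,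
    (λ e → ⊥-elim (label≢outer c′ (lo + l) y (sym (trans (sym b) (trans e b′)))))
  ... | inj₂ (_ , _ , a , b) | inj₁ (a′ , b′) =
    (λ e → ⊥-elim (label≢outer c (lo + l) x (trans (sym a) (trans e a′)))) ,
    (λ e → ⊥-elim (label≢outer c′ (lo + l) x (trans (sym b) (trans e b′))))
  ... | inj₂ (p , q , a , b) | inj₂ (p′ , q′ , a′ , b′) =
    (λ e → trans b (trans (proj₁ (k x y p q p′ q′) (trans (sym a) (trans e a′))) (sym b′))) ,
    (λ e → trans a (trans (proj₂ (k x y p q p′ q′) (trans (sym b) (trans e b′))) (sym a′)))

-- Canonical form

swap : ℕ → ℕ → ℕ
swap k x with x ≟ k
... | yes _ = suc k
... | no _ with x ≟ suc k
...   | yes _ = k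
...   | no _  = x

swap-k : ∀ k → swap k k ≡ suc k
swap-k k with k ≟ k
... | yes _ = refl
... | no ¬p = ⊥-elim (¬p refl)

swap-suc : ∀ k → swap k (suc k) ≡ k
swap-suc k with suc k ≟ k
... | yes p = ⊥-elim (<-irrefl (sym p) ≤-refl)
... | no _ with suc k ≟ suc k
...   | yes _ = refl
...   | no ¬p = ⊥-elim (¬p refl)

swap-< : ∀ k x → x < k → swap k x ≡ x
swap-< k x p with x ≟ k
... | yes e = ⊥-elim (<-irrefl e p)
... | no _ with x ≟ suc k
...   | yes e = ⊥-elim (<-irrefl e (m<n⇒m<1+n p))
...   | no _  = refl

swap-involutive : ∀ k x → swap k (swap k x) ≡ x
swap-involutive k x with x ≟ k
... | yes refl = swap-suc k
... | no x≢k with x ≟ suc k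
...   | yes refl = swap-k k
...   | no x≢1+k with x ≟ k
...     | yes e = ⊥-elim (x≢k e)
...     | no _ with x ≟ suc k
...       | yes e = ⊥-elim (x≢1+k e)
...       | no _  = refl

swap-injective : ∀ k a b → swap k a ≡ swap k b → a ≡ b
swap-injective k a b e = trans (sym (swap-involutive k a)) (trans (cong (swap k) e) (swap-involutive k b))

sameBlocks-swapCore : ∀ r s lo →
  SameBlocksOn (label (ring 0 r (core s)) lo) (label (ring s 0 (core r)) lo) lo (lo + width (ring 0 r (core s)))
sameBlocks-swapCore r s lo = sameBlocks-relabel (swap 0) relabelled (swap-injective 0)
  where
  lo+0 : lo + 0 ≡ lo
  lo+0 = +-identityʳ lo
  relabelled : ∀ x → lo ≤ x → x < lo + (s + r) →
    label (ring s 0 (core r)) lo x ≡ swap 0 (label (ring 0 r (core s)) lo x)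
  relabelled x p q with <⊎≥ x (lo + s)
  ... | inj₁ x<lo+s = begin
    label (ring s 0 (core r)) lo x           ≡⟨ label-left s 0 (core r) lo x x<lo+s ⟩
    1                                        ≡⟨ sym (swap-k 0) ⟩
    swap 0 0                                 ≡⟨ cong (swap 0) (sym (label-noLeft r (core s) lo x p x<lo+s)) ⟩
    swap 0 (label (ring 0 r (core s)) lo x)  ∎
    where open ≡-Reasoning
  ... | inj₂ lo+s≤x = begin
    label (ring s 0 (core r)) lo x           ≡⟨ label-middle s 0 (core r) lo x lo+s≤x (subst (x <_) (sym (+-assoc lo s r)) q) ⟩
    0                                        ≡⟨ sym (swap-suc 0) ⟩
    swap 0 1                                 ≡⟨ cong (swap 0) (sym (label-right 0 r (core s) lo x
                                                  (subst (λ t → t + s ≤ x) (sym lo+0) lo+s≤x))) ⟩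
    swap 0 (label (ring 0 r (core s)) lo x)  ∎
    where open ≡-Reasoning

sameBlocks-swapRings : ∀ {m} r l₁ (c₂ : Nest m) lo →
  SameBlocksOn (label (ring 0 r (ring l₁ 0 c₂)) lo) (label (ring l₁ 0 (ring 0 r c₂)) lo)
               lo (lo + width (ring 0 r (ring l₁ 0 c₂)))
sameBlocks-swapRings {m} r l₁ c₂ lo = sameBlocks-relabel (swap (suc m)) relabelled (swap-injective (suc m))
  where
  open ≡-Reasoning
  w = width c₂
  G H : ℕ → ℕ
  G = label (ring 0 r (ring l₁ 0 c₂)) lo
  H = label (ring l₁ 0 (ring 0 r c₂)) lo

  shape₁ : ∀ lo l₁ w → lo + l₁ + w ≡ lo + (l₁ + w + 0)
  shape₁ = solve-∀
  shape₂ : ∀ lo l₁ w r → lo + (l₁ + w + 0 + r) ≡ lo + l₁ + (w + r)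
  shape₂ = solve-∀
  shape₃ : ∀ lo l₁ w → lo + l₁ + w ≡ lo + l₁ + 0 + w
  shape₃ = solve-∀
  shape₄ : ∀ lo l₁ w → lo + l₁ + w ≡ lo + 0 + (l₁ + w + 0)
  shape₄ = solve-∀

  G-inner : ∀ x → lo ≤ x → x < lo + l₁ + w → G x ≡ label (ring l₁ 0 c₂) lo x
  G-inner x p q = label-noLeft r (ring l₁ 0 c₂) lo x p (subst (x <_) (shape₁ lo l₁ w) q)

  relabelled : ∀ x → lo ≤ x → x < lo + (l₁ + w + 0 + r) → H x ≡ swap (suc m) (G x)
  relabelled x p q with interval-trichotomy (lo + l₁) (lo + l₁ + w) x
  ... | inj₁ x<lo+l₁ = begin
    H x                   ≡⟨ label-left l₁ 0 (ring 0 r c₂) lo x x<lo+l₁ ⟩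
    suc (suc m)           ≡⟨ sym (swap-k (suc m)) ⟩
    swap (suc m) (suc m)  ≡⟨ cong (swap (suc m)) (sym (trans (G-inner x p (≤-trans x<lo+l₁ (m≤m+n _ w)))
                                                               (label-left l₁ 0 c₂ lo x x<lo+l₁))) ⟩
    swap (suc m) (G x)    ∎
  ... | inj₂ (inj₁ (lo+l₁≤x , x<lo+l₁+w)) = begin
    H x                                  ≡⟨ label-middle l₁ 0 (ring 0 r c₂) lo x lo+l₁≤x
                                              (subst (x <_) (shape₂ lo l₁ w r) q) ⟩
    label (ring 0 r c₂) (lo + l₁) x      ≡⟨ label-noLeft r c₂ (lo + l₁) x lo+l₁≤x x<lo+l₁+w ⟩
    label c₂ (lo + l₁) x                 ≡⟨ sym (swap-< (suc m) _ (s≤s (label≤depth c₂ _ x))) ⟩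
    swap (suc m) (label c₂ (lo + l₁) x)  ≡⟨ cong (swap (suc m)) (sym (trans (G-inner x p x<lo+l₁+w)
                                              (label-middle l₁ 0 c₂ lo x lo+l₁≤x x<lo+l₁+w))) ⟩
    swap (suc m) (G x)                   ∎
  ... | inj₂ (inj₂ lo+l₁+w≤x) = begin
    H x                              ≡⟨ label-middle l₁ 0 (ring 0 r c₂) lo x (≤-trans (m≤m+n _ w) lo+l₁+w≤x)
                                          (subst (x <_) (shape₂ lo l₁ w r) q) ⟩
    label (ring 0 r c₂) (lo + l₁) x  ≡⟨ label-right 0 r c₂ (lo + l₁) x (subst (_≤ x) (shape₃ lo l₁ w) lo+l₁+w≤x) ⟩
    suc m                            ≡⟨ sym (swap-suc (suc m)) ⟩
    swap (suc m) (suc (suc m))       ≡⟨ cong (swap (suc m)) (sym (label-right 0 r (ring l₁ 0 c₂) lo x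
                                          (subst (_≤ x) (shape₄ lo l₁ w) lo+l₁+w≤x))) ⟩
    swap (suc m) (G x)               ∎

record CanonicalForm {m} (c : Nest m) : Set where
  constructor canonicalForm
  field
    nest       : Nest m
    canonical  : Canonical nest
    width≡     : width nest ≡ width c
    sameBlocks : ∀ lo → SameBlocksOn (label c lo) (label nest lo) lo (lo + width c)

-- Canonicalisation pushes rings without left part inwards past inner rings
-- without right part (and past the core), one swap at a time.
mutual
  canonicalise : ∀ {m} (c : Nest m) → Proper c → CanonicalForm c
  canonicalise (core s) p = canonicalForm (core s) p refl (λ lo → sameBlocks-refl _ _ _)
  canonicalise (ring l r c) (l+r≥1 , p) = canonicaliseRing l r c (canonicalise c p) l+r≥1

  canonicaliseRing : ∀ {m} l r (c : Nest m) → CanonicalForm c → 1 ≤ l + r → CanonicalForm (ring l r c)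
  canonicaliseRing (suc l) r c (canonicalForm c₁ can w≡ k) l+r≥1 =
    canonicalForm (ring (suc l) r c₁) (l+r≥1 , can , λ ()) (cong (λ w → suc l + w + r) w≡)
      (λ lo → sameBlocks-ring (suc l) r c c₁ lo (sym w≡) (k (lo + suc l)))
  canonicaliseRing zero r c (canonicalForm (core s) s≥1 w≡ k) r≥1 =
    canonicalForm (ring s 0 (core r)) (subst (1 ≤_) (sym (+-identityʳ s)) s≥1 , r≥1 , λ s≡0 → <-irrefl (sym s≡0) s≥1)
      (trans (+-identityʳ (s + r)) (cong (_+ r) w≡))
      (λ lo → sameBlocks-trans (sameBlocks-ring 0 r c (core s) lo (sym w≡) (k (lo + 0)))
                 (subst (SameBlocksOn _ _ lo) (cong (λ w → lo + (w + r)) w≡) (sameBlocks-swapCore r s lo)))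
  canonicaliseRing zero r c (canonicalForm c₁@(ring l₁ (suc r₁) c₂) can w≡ k) r≥1 =
    canonicalForm (ring 0 r c₁) (r≥1 , can , λ _ → s≤s z≤n) (cong (_+ r) w≡)
      (λ lo → sameBlocks-ring 0 r c c₁ lo (sym w≡) (k (lo + 0)))
  canonicaliseRing zero r c (canonicalForm (ring l₁ zero c₂) (l₁≥1 , can₂ , _) w≡ k) r≥1
    with canonicalise (ring 0 r c₂) (r≥1 , Canonical⇒Proper c₂ can₂)
  ... | canonicalForm c₃ can₃ w₃≡ k₃ =
    canonicalForm (ring l₁ 0 c₃)
      (l₁≥1 , can₃ , λ l₁≡0 → ⊥-elim (<-irrefl (sym l₁≡0) (subst (1 ≤_) (+-identityʳ l₁) l₁≥1)))
      (trans (cong (λ w → l₁ + w + 0) w₃≡) (trans (regroup l₁ (width c₂) r) (cong (_+ r) w≡)))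
      (λ lo → sameBlocks-trans (canonicaliseInner lo) (sameBlocks-trans (swapRings lo) (canonicaliseSwapped lo)))
    where
    regroup : ∀ l₁ w r → l₁ + (w + r) + 0 ≡ l₁ + w + 0 + r
    regroup = solve-∀
    hi : ℕ → ℕ
    hi lo = lo + width (ring 0 r c)
    canonicaliseInner : ∀ lo → SameBlocksOn (label (ring 0 r c) lo) (label (ring 0 r (ring l₁ 0 c₂)) lo) lo (hi lo)
    canonicaliseInner lo = sameBlocks-ring 0 r c (ring l₁ 0 c₂) lo (sym w≡) (k (lo + 0))
    swapRings : ∀ lo → SameBlocksOn (label (ring 0 r (ring l₁ 0 c₂)) lo) (label (ring l₁ 0 (ring 0 r c₂)) lo) lo (hi lo)
    swapRings lo = subst (SameBlocksOn _ _ lo) (cong (λ w → lo + (w + r)) w≡) (sameBlocks-swapRings r l₁ c₂ lo)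
    canonicaliseSwapped : ∀ lo → SameBlocksOn (label (ring l₁ 0 (ring 0 r c₂)) lo) (label (ring l₁ 0 c₃) lo) lo (hi lo)
    canonicaliseSwapped lo = subst (SameBlocksOn _ _ lo) (trans (cong (lo +_) (regroup l₁ (width c₂) r)) (cong (λ w → lo + (w + r)) w≡))
                               (sameBlocks-ring l₁ 0 (ring 0 r c₂) c₃ lo (sym w₃≡) (k₃ (lo + l₁)))

-- Canonical nests are determined by their partition

≥1⇒≡suc : ∀ {n} → 1 ≤ n → Σ ℕ λ t → n ≡ suc t
≥1⇒≡suc {suc n} _ = n , refl

middle⊆ring : ∀ lo l w r → lo + l + w ≤ lo + (l + w + r)
middle⊆ring lo l w r = subst (lo + l + w ≤_) (regroup lo l w r) (m≤m+n _ r)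
  where
  regroup : ∀ lo l w r → lo + l + w + r ≡ lo + (l + w + r)
  regroup = solve-∀

LeftRun : (ℕ → ℕ) → ℕ → ℕ → Set
LeftRun g lo p = (∀ x → lo ≤ x → x < lo + p → g x ≡ g lo) × g (lo + p) ≢ g lo

RightRun : (ℕ → ℕ) → ℕ → ℕ → Set
RightRun g e z = (∀ x → e < x → x ≤ z → g x ≡ g z) × g e ≢ g z

leftRun-unique : ∀ {g h lo hi p q} → SameBlocksOn g h lo hi → LeftRun g lo p → LeftRun h lo q →
  lo + p < hi → lo + q < hi → p ≡ q
leftRun-unique {lo = lo} {p = p} {q} k (g-run , g-end) (h-run , h-end) p<hi q<hi with <-cmp p q
... | tri≈ _ p≡q _ = p≡q
... | tri< p<q _ _ = ⊥-elim (g-end (proj₂ (k (lo + p) lo (m≤m+n lo p) p<hi ≤-refl (≤-<-trans (m≤m+n lo p) p<hi))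
                                       (h-run (lo + p) (m≤m+n lo p) (+-monoʳ-< lo p<q))))
... | tri> _ _ q<p = ⊥-elim (h-end (proj₁ (k (lo + q) lo (m≤m+n lo q) q<hi ≤-refl (≤-<-trans (m≤m+n lo q) q<hi))
                                       (g-run (lo + q) (m≤m+n lo q) (+-monoʳ-< lo q<p))))

rightRun-unique : ∀ {g h lo hi e e′ z} → SameBlocksOn g h lo hi → RightRun g e z → RightRun h e′ z →
  lo ≤ e → lo ≤ e′ → e < z → e′ < z → z < hi → e ≡ e′
rightRun-unique {e = e} {e′} {z} k (g-run , g-end) (h-run , h-end) lo≤e lo≤e′ e<z e′<z z<hi with <-cmp e e′
... | tri≈ _ e≡e′ _ = e≡e′
... | tri< e<e′ _ _ = ⊥-elim (h-end (proj₁ (k e′ z lo≤e′ (<-trans e′<z z<hi) (≤-trans lo≤e (<⇒≤ e<z)) z<hi)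
                                         (g-run e′ e<e′ (<⇒≤ e′<z))))
... | tri> _ _ e′<e = ⊥-elim (g-end (proj₂ (k e z lo≤e (<-trans e<z z<hi) (≤-trans lo≤e (<⇒≤ e<z)) z<hi)
                                         (h-run e e′<e (<⇒≤ e<z))))

module _ {m} (l r : ℕ) (c : Nest m) (lo t : ℕ) (w≡ : width c ≡ suc t) where

  middle-nonempty : lo + l < lo + l + width c
  middle-nonempty = subst (lo + l <_) (cong (lo + l +_) (sym w≡)) (m<m+n (lo + l) (s≤s z≤n))

  middle-end : suc (lo + l + t) ≡ lo + l + width c
  middle-end = trans (sym (+-suc _ t)) (cong (lo + l +_) (sym w≡))

  last-middle : lo + l + t < lo + l + width c
  last-middle = subst (suc (lo + l + t) ≤_) middle-end ≤-refl

  label-middle≢outer : ∀ x → lo + l ≤ x → x < lo + l + width c → label (ring l r c) lo x ≢ suc m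
  label-middle≢outer x p q e = label≢outer c (lo + l) x (trans (sym (label-middle l r c lo x p q)) e)

  leftRun-ring : 1 ≤ l → LeftRun (label (ring l r c) lo) lo l
  leftRun-ring l≥1 =
    (λ x _ x<lo+l → trans (label-left l r c lo x x<lo+l) (sym outer-lo)) ,
    (λ e → label-middle≢outer (lo + l) ≤-refl middle-nonempty (trans e outer-lo))
    where
    outer-lo = label-left l r c lo lo (m<m+n lo l≥1)

  rightRun-ring : ∀ z → lo + l + width c ≤ z → RightRun (label (ring l r c) lo) (lo + l + t) z
  rightRun-ring z p =
    (λ x e<x _ → trans (label-right l r c lo x (subst (_≤ x) middle-end e<x)) (sym outer-z)) ,
    (λ e → label-middle≢outer (lo + l + t) (m≤m+n _ t) last-middle (trans e outer-z))
    where
    outer-z = label-right l r c lo z p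

sameBlocks-restrict : ∀ {g h lo hi lo′ hi′} → lo ≤ lo′ → hi′ ≤ hi → SameBlocksOn g h lo hi → SameBlocksOn g h lo′ hi′
sameBlocks-restrict lo≤lo′ hi′≤hi k x y a b c d =
  k x y (≤-trans lo≤lo′ a) (<-≤-trans b hi′≤hi) (≤-trans lo≤lo′ c) (<-≤-trans d hi′≤hi)

sameBlocks-pointwise : ∀ {g g₁ h h₁ lo hi} →
  (∀ x → lo ≤ x → x < hi → g x ≡ g₁ x) → (∀ x → lo ≤ x → x < hi → h x ≡ h₁ x) →
  SameBlocksOn g h lo hi → SameBlocksOn g₁ h₁ lo hi
sameBlocks-pointwise g≗ h≗ k x y a b c d =
  (λ e → trans (sym (h≗ x a b)) (trans (proj₁ (k x y a b c d) (trans (g≗ x a b) (trans e (sym (g≗ y c d))))) (h≗ y c d))) ,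
  (λ e → trans (sym (g≗ x a b)) (trans (proj₂ (k x y a b c d) (trans (h≗ x a b) (trans e (sym (h≗ y c d))))) (g≗ y c d)))

sameBlocks-middle : ∀ {m} l r (c c′ : Nest m) lo → width c ≡ width c′ →
  SameBlocksOn (label (ring l r c) lo) (label (ring l r c′) lo) lo (lo + width (ring l r c)) →
  SameBlocksOn (label c (lo + l)) (label c′ (lo + l)) (lo + l) (lo + l + width c)
sameBlocks-middle l r c c′ lo w≡ k =
  sameBlocks-pointwise (λ x p q → label-middle l r c lo x p q)
                       (λ x p q → label-middle l r c′ lo x p (subst (λ w → x < lo + l + w) w≡ q))
    (sameBlocks-restrict (m≤m+n lo l) (middle⊆ring lo l (width c) r) k)

record GapInFirstBlock (g : ℕ → ℕ) (lo hi : ℕ) : Set where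
  constructor gap
  field
    {between beyond} : ℕ
    lo<between     : lo < between
    between<beyond : between < beyond
    beyond<hi      : beyond < hi
    beyond-in      : g beyond ≡ g lo
    between-out    : g between ≢ g lo

gap-transport : ∀ {g h lo hi} → SameBlocksOn g h lo hi → GapInFirstBlock g lo hi → GapInFirstBlock h lo hi
gap-transport {lo = lo} k (gap {y} {x} lo<y y<x x<hi x-in y-out) =
  gap lo<y y<x x<hi
    (proj₁ (k x lo (<⇒≤ (<-trans lo<y y<x)) x<hi ≤-refl lo<hi) x-in)
    (λ e → y-out (proj₂ (k y lo (<⇒≤ lo<y) (<-trans y<x x<hi) ≤-refl lo<hi) e))
  where
  lo<hi = <-trans lo<y (<-trans y<x x<hi)

gap-noLeft : ∀ {m} r (c : Nest m) lo →
  GapInFirstBlock (label c lo) lo (lo + width c) → GapInFirstBlock (label (ring 0 r c) lo) lo (lo + width (ring 0 r c))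
gap-noLeft r c lo (gap {y} {x} lo<y y<x x<hi x-in y-out) =
  gap lo<y y<x (≤-trans x<hi (+-monoʳ-≤ lo (m≤m+n (width c) r)))
    (trans (noLeft x (<⇒≤ (<-trans lo<y y<x)) x<hi) (trans x-in (sym (noLeft lo ≤-refl lo<hi))))
    (λ e → y-out (trans (sym (noLeft y (<⇒≤ lo<y) (<-trans y<x x<hi))) (trans e (noLeft lo ≤-refl lo<hi))))
  where
  noLeft = label-noLeft r c lo
  lo<hi = <-trans lo<y (<-trans y<x x<hi)

gap-opensRight : ∀ {m} (c : Nest m) → Canonical c → OpensRight c → ∀ lo → GapInFirstBlock (label c lo) lo (lo + width c)
gap-opensRight (ring (suc l) (suc r) c) (_ , can , _) _ lo with ≥1⇒≡suc (width-pos c (Canonical⇒Proper c can))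
... | t , w≡ =
  gap (m<m+n lo (s≤s z≤n)) (middle-nonempty (suc l) (suc r) c lo t w≡)
    (subst (lo + suc l + width c <_) (regroup lo (suc l) (width c) r) (m<m+n _ (s≤s z≤n)))
    (trans (label-right (suc l) (suc r) c lo _ ≤-refl) (sym outer-lo))
    (λ e → label-middle≢outer (suc l) (suc r) c lo t w≡ _ ≤-refl (middle-nonempty (suc l) (suc r) c lo t w≡)
             (trans e outer-lo))
  where
  outer-lo = label-left (suc l) (suc r) c lo lo (m<m+n lo (s≤s z≤n))
  regroup : ∀ lo l w r → lo + l + w + suc r ≡ lo + (l + w + suc r)
  regroup = solve-∀
gap-opensRight (ring zero (suc r) c) (_ , can , opens) _ lo = gap-noLeft (suc r) c lo (gap-opensRight c can (opens refl) lo)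

gap-noLeftRing : ∀ {m} r (c : Nest m) → Canonical (ring 0 r c) → ∀ lo →
  GapInFirstBlock (label (ring 0 r c) lo) lo (lo + width (ring 0 r c))
gap-noLeftRing r c (_ , can , opens) lo = gap-noLeft r c lo (gap-opensRight c can (opens refl) lo)

noGap-leftOnly : ∀ {m} a (c : Nest m) lo →
  GapInFirstBlock (label (ring (suc a) 0 c) lo) lo (lo + width (ring (suc a) 0 c)) → ⊥
noGap-leftOnly {m} a c lo (gap {y} {x} lo<y y<x x<hi x-in y-out) with <⊎≥ x (lo + suc a)
... | inj₁ x<lo+l = y-out (trans (label-left (suc a) 0 c lo y (<-trans y<x x<lo+l)) (sym outer-lo))
  where outer-lo = label-left (suc a) 0 c lo lo (m<m+n lo (s≤s z≤n))
... | inj₂ lo+l≤x = label≢outer c (lo + suc a) x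
        (trans (sym (label-middle (suc a) 0 c lo x lo+l≤x (subst (x <_) (regroup lo (suc a) (width c)) x<hi)))
               (trans x-in (label-left (suc a) 0 c lo lo (m<m+n lo (s≤s z≤n)))))
  where
  regroup : ∀ lo l w → lo + (l + w + 0) ≡ lo + l + w
  regroup = solve-∀

rightStart≤last : ∀ lo l w b z → lo + (l + w + suc b) ≡ suc z → lo + l + w ≤ z
rightStart≤last lo l w b z e = subst (lo + l + w ≤_) (suc-injective (trans (sym (regroup lo l w b)) e)) (m≤m+n _ b)
  where
  regroup : ∀ lo l w b → lo + (l + w + suc b) ≡ suc (lo + l + w + b)
  regroup = solve-∀

lastMiddle≡last : ∀ lo l w t z → w ≡ suc t → lo + (l + w + 0) ≡ suc z → lo + l + t ≡ z
lastMiddle≡last lo l w t z refl e = suc-injective (trans (sym (regroup lo l t)) e)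
  where
  regroup : ∀ lo l t → lo + (l + suc t + 0) ≡ suc (lo + l + t)
  regroup = solve-∀

module _ {m} (c : Nest m) (lo z : ℕ) where

  firstLast-twoSided : ∀ a b → lo + width (ring (suc a) (suc b) c) ≡ suc z →
    label (ring (suc a) (suc b) c) lo lo ≡ label (ring (suc a) (suc b) c) lo z
  firstLast-twoSided a b last = trans (label-left (suc a) (suc b) c lo lo (m<m+n lo (s≤s z≤n)))
    (sym (label-right (suc a) (suc b) c lo z (rightStart≤last lo (suc a) (width c) b z last)))

  firstLast-leftOnly : ∀ a t → width c ≡ suc t → lo + width (ring (suc a) 0 c) ≡ suc z →
    label (ring (suc a) 0 c) lo lo ≢ label (ring (suc a) 0 c) lo z
  firstLast-leftOnly a t w≡ last e =
    label-middle≢outer (suc a) 0 c lo t w≡ z (subst (lo + suc a ≤_) z≡ (m≤m+n _ t))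
      (subst (_< lo + suc a + width c) z≡ (last-middle (suc a) 0 c lo t w≡))
      (trans (sym e) (label-left (suc a) 0 c lo lo (m<m+n lo (s≤s z≤n))))
    where
    z≡ = lastMiddle≡last lo (suc a) (width c) t z w≡ last

  firstLast-rightOnly : ∀ b → 1 ≤ width c → lo + width (ring 0 (suc b) c) ≡ suc z →
    label (ring 0 (suc b) c) lo lo ≢ label (ring 0 (suc b) c) lo z
  firstLast-rightOnly b w≥1 last e =
    label≢outer c lo lo (trans (sym (label-noLeft (suc b) c lo lo ≤-refl (m<m+n lo w≥1)))
      (trans e (label-right 0 (suc b) c lo z (rightStart≤last lo 0 (width c) b z last))))

data Shape : ℕ → ℕ → Set where
  twoSided  : ∀ a b → Shape (suc a) (suc b)
  leftOnly  : ∀ a → Shape (suc a) 0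
  rightOnly : ∀ b → Shape 0 (suc b)

shape : ∀ l r → 1 ≤ l + r → Shape l r
shape (suc a) (suc b) _ = twoSided a b
shape (suc a) zero    _ = leftOnly a
shape zero    (suc b) _ = rightOnly b

module _ {m} (l r l′ r′ : ℕ) (c c′ : Nest m) (lo hi t t′ : ℕ) (w≡ : width c ≡ suc t) (w′≡ : width c′ ≡ suc t′)
         (k : SameBlocksOn (label (ring l r c) lo) (label (ring l′ r′ c′) lo) lo hi) where

  leftRun-rings : 1 ≤ l → 1 ≤ l′ → lo + width (ring l r c) ≤ hi → lo + width (ring l′ r′ c′) ≤ hi → l ≡ l′
  leftRun-rings l≥1 l′≥1 R≤hi R′≤hi =
    leftRun-unique k (leftRun-ring l r c lo t w≡ l≥1) (leftRun-ring l′ r′ c′ lo t′ w′≡ l′≥1)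
      (<-≤-trans (<-≤-trans (middle-nonempty l r c lo t w≡) (middle⊆ring lo l (width c) r)) R≤hi)
      (<-≤-trans (<-≤-trans (middle-nonempty l′ r′ c′ lo t′ w′≡) (middle⊆ring lo l′ (width c′) r′)) R′≤hi)

  rightRun-rings : ∀ z → lo + l + width c ≤ z → lo + l′ + width c′ ≤ z → z < hi → lo + l + t ≡ lo + l′ + t′
  rightRun-rings z P P′ z<hi =
    rightRun-unique k (rightRun-ring l r c lo t w≡ z P) (rightRun-ring l′ r′ c′ lo t′ w′≡ z P′)
      (≤-trans (m≤m+n lo l) (m≤m+n _ t)) (≤-trans (m≤m+n lo l′) (m≤m+n _ t′))
      (<-≤-trans (last-middle l r c lo t w≡) P) (<-≤-trans (last-middle l′ r′ c′ lo t′ w′≡) P′) z<hi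

sameBlocks-firstLast : ∀ {g h lo z} → lo ≤ z → SameBlocksOn g h lo (suc z) →
  (g lo ≡ g z → h lo ≡ h z) × (h lo ≡ h z → g lo ≡ g z)
sameBlocks-firstLast lo≤z k = k _ _ ≤-refl (s≤s lo≤z) lo≤z ≤-refl

-- The outer ring is read off the partition: whether the first and last
-- positions share a block tells whether both sides are nonempty, the runs at
-- the two ends give the side widths, and a gap in the first block tells a
-- left-only ring from a (canonical) right-only one.
module _ {m} (c c′ : Nest m) (lo t t′ z : ℕ) (w≡ : width c ≡ suc t) (w′≡ : width c′ ≡ suc t′) (lo≤z : lo ≤ z) where

  private
    w≥1 : 1 ≤ width c
    w≥1 = subst (1 ≤_) (sym w≡) (s≤s z≤n)
    w′≥1 : 1 ≤ width c′
    w′≥1 = subst (1 ≤_) (sym w′≡) (s≤s z≤n)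

  compareShapes : ∀ {l r l′ r′} → Shape l r → Shape l′ r′ → Canonical (ring l r c) → Canonical (ring l′ r′ c′) →
    lo + width (ring l r c) ≡ suc z → lo + width (ring l′ r′ c′) ≡ suc z →
    SameBlocksOn (label (ring l r c) lo) (label (ring l′ r′ c′) lo) lo (suc z) → l ≡ l′ × width c ≡ width c′
  compareShapes (twoSided a b) (twoSided a′ b′) _ _ last last′ k =
    l≡ , trans w≡ (trans (cong suc t≡) (sym w′≡))
    where
    l≡ : suc a ≡ suc a′
    l≡ = leftRun-rings _ (suc b) _ (suc b′) c c′ lo _ t t′ w≡ w′≡ k (s≤s z≤n) (s≤s z≤n)
           (≤-reflexive last) (≤-reflexive last′)
    e≡ : lo + suc a + t ≡ lo + suc a′ + t′
    e≡ = rightRun-rings (suc a) (suc b) (suc a′) (suc b′) c c′ lo _ t t′ w≡ w′≡ k z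
           (rightStart≤last lo (suc a) (width c) b z last) (rightStart≤last lo (suc a′) (width c′) b′ z last′) ≤-refl
    t≡ : t ≡ t′
    t≡ = +-cancelˡ-≡ (lo + suc a) t t′ (trans e≡ (cong (λ u → lo + u + t′) (sym l≡)))
  compareShapes (leftOnly a) (leftOnly a′) _ _ last last′ k =
    l≡ , +-cancelˡ-≡ (suc a) _ _ (+-cancelʳ-≡ 0 _ _ (+-cancelˡ-≡ lo _ _
           (trans last (trans (sym last′) (cong (λ u → lo + (u + width c′ + 0)) (sym l≡))))))
    where
    l≡ : suc a ≡ suc a′
    l≡ = leftRun-rings _ 0 _ 0 c c′ lo _ t t′ w≡ w′≡ k (s≤s z≤n) (s≤s z≤n) (≤-reflexive last) (≤-reflexive last′)
  compareShapes (rightOnly b) (rightOnly b′) _ _ last last′ k =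
    refl , trans w≡ (trans (cong suc (+-cancelˡ-≡ (lo + 0) t t′ e≡)) (sym w′≡))
    where
    e≡ : lo + 0 + t ≡ lo + 0 + t′
    e≡ = rightRun-rings 0 (suc b) 0 (suc b′) c c′ lo _ t t′ w≡ w′≡ k z (rightStart≤last lo 0 (width c) b z last)
           (rightStart≤last lo 0 (width c′) b′ z last′) ≤-refl
  compareShapes (twoSided a b) (leftOnly a′) _ _ last last′ k =
    ⊥-elim (firstLast-leftOnly c′ lo z a′ t′ w′≡ last′
              (proj₁ (sameBlocks-firstLast lo≤z k) (firstLast-twoSided c lo z a b last)))
  compareShapes (twoSided a b) (rightOnly b′) _ _ last last′ k =
    ⊥-elim (firstLast-rightOnly c′ lo z b′ w′≥1 last′
              (proj₁ (sameBlocks-firstLast lo≤z k) (firstLast-twoSided c lo z a b last)))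
  compareShapes (leftOnly a) (twoSided a′ b′) _ _ last last′ k =
    ⊥-elim (firstLast-leftOnly c lo z a t w≡ last
              (proj₂ (sameBlocks-firstLast lo≤z k) (firstLast-twoSided c′ lo z a′ b′ last′)))
  compareShapes (rightOnly b) (twoSided a′ b′) _ _ last last′ k =
    ⊥-elim (firstLast-rightOnly c lo z b w≥1 last
              (proj₂ (sameBlocks-firstLast lo≤z k) (firstLast-twoSided c′ lo z a′ b′ last′)))
  compareShapes (leftOnly a) (rightOnly b′) _ canR′ last last′ k =
    ⊥-elim (noGap-leftOnly a c lo (subst (GapInFirstBlock _ lo) (sym last)
      (gap-transport (sameBlocks-sym k) (subst (GapInFirstBlock _ lo) last′ (gap-noLeftRing (suc b′) c′ canR′ lo)))))
  compareShapes (rightOnly b) (leftOnly a′) canR _ last last′ k =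
    ⊥-elim (noGap-leftOnly a′ c′ lo (subst (GapInFirstBlock _ lo) (sym last′)
      (gap-transport k (subst (GapInFirstBlock _ lo) last (gap-noLeftRing (suc b) c canR lo)))))

ring-outer-unique : ∀ {m l r l′ r′} (c c′ : Nest m) lo →
  Canonical (ring l r c) → Canonical (ring l′ r′ c′) → width (ring l r c) ≡ width (ring l′ r′ c′) →
  SameBlocksOn (label (ring l r c) lo) (label (ring l′ r′ c′) lo) lo (lo + width (ring l r c)) →
  l ≡ l′ × width c ≡ width c′
ring-outer-unique {l = l} {r} {l′} {r′} c c′ lo canR@(l+r≥1 , can , _) canR′@(l′+r′≥1 , can′ , _) w≡ k
  with ≥1⇒≡suc (width-pos c (Canonical⇒Proper c can)) | ≥1⇒≡suc (width-pos c′ (Canonical⇒Proper c′ can′))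
     | ≥1⇒≡suc (≤-trans (width-pos (ring l r c) (Canonical⇒Proper (ring l r c) canR)) (m≤n+m _ lo))
... | t , wc≡ | t′ , wc′≡ | z , last =
  compareShapes c c′ lo t t′ z wc≡ wc′≡ lo≤z (shape l r l+r≥1) (shape l′ r′ l′+r′≥1) canR canR′
    last (trans (cong (lo +_) (sym w≡)) last) (subst (SameBlocksOn _ _ lo) last k)
  where
  lo≤z : lo ≤ z
  lo≤z = ≤-pred (subst (lo <_) last (m<m+n lo (width-pos (ring l r c) (Canonical⇒Proper (ring l r c) canR))))

canonical-unique : ∀ {m} (c c′ : Nest m) → Canonical c → Canonical c′ → width c ≡ width c′ → ∀ lo →
  SameBlocksOn (label c lo) (label c′ lo) lo (lo + width c) → c ≡ c′
canonical-unique (core s) (core s′) _ _ w≡ lo k = cong core w≡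
canonical-unique (ring l r c) (ring l′ r′ c′) canR canR′ w≡ lo k with ring-outer-unique c c′ lo canR canR′ w≡ k
... | refl , wc≡ with +-cancelˡ-≡ (l + width c) r r′ (trans w≡ (cong (λ w → l + w + r′) (sym wc≡)))
... | refl = cong (ring l r) (canonical-unique c c′ (proj₁ (proj₂ canR)) (proj₁ (proj₂ canR′)) wc≡ (lo + l)
                                (sameBlocks-middle l r c c′ lo wc≡ k))

-- The partition of a nest is order-consecutive

ring-outerCell : ∀ {m} l r (c : Nest m) → 1 ≤ l + r → Proper c → ∀ lo →
  Σ ℕ λ x → lo ≤ x × x < lo + width (ring l r c) × label (ring l r c) lo x ≡ suc m
ring-outerCell (suc l) r c _ p lo =
  lo , ≤-refl ,
  <-≤-trans (m<m+n lo (s≤s z≤n)) (≤-trans (m≤m+n _ (width c)) (middle⊆ring lo (suc l) (width c) r)) ,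
  label-left (suc l) r c lo lo (m<m+n lo (s≤s z≤n))
ring-outerCell zero r c r≥1 p lo =
  lo + 0 + width c , ≤-trans (m≤m+n lo 0) (m≤m+n _ _) ,
  subst (lo + 0 + width c <_) (regroup lo (width c) r) (m<m+n _ r≥1) , label-right 0 r c lo _ ≤-refl
  where
  regroup : ∀ lo w r → lo + 0 + w + r ≡ lo + (w + r)
  regroup = solve-∀

label-onto : ∀ {m} (c : Nest m) → Proper c → ∀ lo ℓ → ℓ ≤ m →
  Σ ℕ λ x → lo ≤ x × x < lo + width c × label c lo x ≡ ℓ
label-onto (core s) p lo ℓ ℓ≤0 = lo , ≤-refl , m<m+n lo p , sym (n≤0⇒n≡0 ℓ≤0)
label-onto (ring l r c) (l+r≥1 , p) lo ℓ ℓ≤ with m≤n⇒m<n∨m≡n ℓ≤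
... | inj₂ refl = ring-outerCell l r c l+r≥1 p lo
... | inj₁ ℓ< with label-onto c p (lo + l) ℓ (≤-pred ℓ<)
...   | x , lo+l≤x , x< , label≡ =
  x , ≤-trans (m≤m+n lo l) lo+l≤x , <-≤-trans x< (middle⊆ring lo l (width c) r) ,
  trans (label-middle l r c lo x lo+l≤x x<) label≡

record PrefixInterval (g : ℕ → ℕ) (lo hi j : ℕ) : Set where
  constructor prefixInterval
  field
    {start end} : ℕ
    lo≤start    : lo ≤ start
    start≤end   : start ≤ end
    end<hi      : end < hi
    inside      : ∀ x → lo ≤ x → x < hi → (g x ≤ j) ⇔ (start ≤ x × x ≤ end)

prefixInterval-whole : ∀ {m} (c : Nest m) → Proper c → ∀ lo j → m ≤ j → PrefixInterval (label c lo) lo (lo + width c) j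
prefixInterval-whole c p lo j m≤j with ≥1⇒≡suc (width-pos c p)
... | t , w≡ =
  prefixInterval ≤-refl (m≤m+n lo t) (subst (lo + t <_) (cong (lo +_) (sym w≡)) (+-monoʳ-< lo ≤-refl))
    (λ x lo≤x x<hi → mk⇔ (λ _ → lo≤x , ≤-pred (subst (x <_) (trans (cong (lo +_) w≡) (+-suc lo t)) x<hi))
                         (λ _ → ≤-trans (label≤depth c lo x) m≤j))

prefixInterval-label : ∀ {m} (c : Nest m) → Proper c → ∀ lo j → PrefixInterval (label c lo) lo (lo + width c) j
prefixInterval-label (core s) p lo j = prefixInterval-whole (core s) p lo j z≤n
prefixInterval-label {suc m} (ring l r c) p@(_ , pc) lo j with suc m ≤? j
... | yes m<j = prefixInterval-whole (ring l r c) p lo j m<j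
... | no m≮j with prefixInterval-label c pc (lo + l) j
...   | prefixInterval {a} {b} lo+l≤a a≤b b<hi inside =
  prefixInterval (≤-trans (m≤m+n lo l) lo+l≤a) a≤b (<-≤-trans b<hi (middle⊆ring lo l (width c) r)) inside′
  where
  inside′ : ∀ x → lo ≤ x → x < lo + width (ring l r c) → (label (ring l r c) lo x ≤ j) ⇔ (a ≤ x × x ≤ b)
  inside′ x _ _ with interval-trichotomy (lo + l) (lo + l + width c) x
  ... | inj₁ x<lo+l = mk⇔ (λ le → ⊥-elim (m≮j (subst (_≤ j) (label-left l r c lo x x<lo+l) le)))
                          (λ (a≤x , _) → ⊥-elim (<⇒≱ x<lo+l (≤-trans lo+l≤a a≤x)))
  ... | inj₂ (inj₁ (p , q)) = mk⇔ (λ le → Equivalence.to (inside x p q) (subst (_≤ j) (label-middle l r c lo x p q) le))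
                                 (λ ab → subst (_≤ j) (sym (label-middle l r c lo x p q)) (Equivalence.from (inside x p q) ab))
  ... | inj₂ (inj₂ end≤x) = mk⇔ (λ le → ⊥-elim (m≮j (subst (_≤ j) (label-right l r c lo x end≤x) le)))
                                (λ (_ , x≤b) → ⊥-elim (<⇒≱ (≤-<-trans x≤b b<hi) end≤x))

∸-telescope : ∀ {a′ a b b′} → a′ ≤ a → a ≤ b → b ≤ b′ →
  (a ∸ a′) + (suc b ∸ a) + (b′ ∸ b) ≡ suc b′ ∸ a′
∸-telescope {a′} {a} {b} {b′} a′≤a a≤b b≤b′ = +-cancelˡ-≡ a′ _ _ (begin
  a′ + ((a ∸ a′) + (suc b ∸ a) + (b′ ∸ b))  ≡⟨ regroup a′ (a ∸ a′) (suc b ∸ a) (b′ ∸ b) ⟩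
  a′ + (a ∸ a′) + (suc b ∸ a) + (b′ ∸ b)    ≡⟨ cong (λ u → u + (suc b ∸ a) + (b′ ∸ b)) (m+[n∸m]≡n a′≤a) ⟩
  a + (suc b ∸ a) + (b′ ∸ b)                ≡⟨ cong (_+ (b′ ∸ b)) (m+[n∸m]≡n (m≤n⇒m≤1+n a≤b)) ⟩
  suc b + (b′ ∸ b)                          ≡⟨ cong suc (m+[n∸m]≡n b≤b′) ⟩
  suc b′                                    ≡⟨ sym (m+[n∸m]≡n (m≤n⇒m≤1+n (≤-trans a′≤a (≤-trans a≤b b≤b′)))) ⟩
  a′ + (suc b′ ∸ a′)                        ∎)
  where
  open ≡-Reasoning
  regroup : ∀ a′ x y z → a′ + (x + y + z) ≡ a′ + x + y + z
  regroup = solve-∀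

-- Junk value 0 outside [0, k).
extendℕ : ∀ {k} → (Fin k → ℕ) → ℕ → ℕ
extendℕ {k} g x with x <? k
... | yes x<k = g (fromℕ< x<k)
... | no _    = 0

extendℕ-fromℕ< : ∀ {k} (g : Fin k → ℕ) x (x<k : x < k) → extendℕ g x ≡ g (fromℕ< x<k)
extendℕ-fromℕ< {k} g x x<k with x <? k
... | yes _ = refl
... | no x≮k = ⊥-elim (x≮k x<k)

extendℕ-toℕ : ∀ {k} (g : Fin k → ℕ) i → extendℕ g (toℕ i) ≡ g i
extendℕ-toℕ g i = trans (extendℕ-fromℕ< g (toℕ i) (toℕ<n i)) (cong g (fromℕ<-toℕ i (toℕ<n i)))

extendℕ-≥ : ∀ {k} (g : Fin k → ℕ) x → k ≤ x → extendℕ g x ≡ 0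
extendℕ-≥ {k} g x k≤x with x <? k
... | yes x<k = ⊥-elim (<⇒≱ x<k k≤x)
... | no _    = refl

extendℕ-cong : ∀ {k} {g h : Fin k → ℕ} → (∀ i → g i ≡ h i) → ∀ x → extendℕ g x ≡ extendℕ h x
extendℕ-cong {k} g≗h x with x <? k
... | yes _ = g≗h _
... | no _  = refl

extendℕ-zero : ∀ {k} (g : Fin k → ℕ) → (∀ i → g i ≡ 0) → ∀ x → extendℕ g x ≡ 0
extendℕ-zero {k} g g≗0 x with x <? k
... | yes _ = g≗0 _
... | no _  = refl

-- The nest of an order-consecutive partition with a chosen block order: the
-- ring of depth j + 1 is the difference of the intervals covered by the
-- first j + 1 and the first j + 2 blocks.
module OrderedPrefixes {n m : ℕ} (f : Fin n → Fin (suc m)) (f-onto : SurjectiveMap f) (oc : OrderConsecutive f) where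

  private
    π = proj₁ oc
    prefix = proj₂ oc

  rank : ℕ → ℕ
  rank = extendℕ (λ x → toℕ (π ⟨$⟩ˡ f x))

  rank-sameBlock : ∀ x y → (rank (toℕ x) ≡ rank (toℕ y)) ⇔ (f x ≡ f y)
  rank-sameBlock x y = mk⇔
    (λ e → begin
      f x                  ≡⟨ sym (inverseʳ π) ⟩
      π ⟨$⟩ʳ (π ⟨$⟩ˡ f x)  ≡⟨ cong (π ⟨$⟩ʳ_) (toℕ-injective
                                 (trans (sym (extendℕ-toℕ _ x)) (trans e (extendℕ-toℕ _ y)))) ⟩
      π ⟨$⟩ʳ (π ⟨$⟩ˡ f y)  ≡⟨ inverseʳ π ⟩
      f y                  ∎)
    (λ e → trans (extendℕ-toℕ _ x) (trans (cong (λ b → toℕ (π ⟨$⟩ˡ b)) e) (sym (extendℕ-toℕ _ y))))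
    where open ≡-Reasoning

  rank≤m : ∀ x → rank x ≤ m
  rank≤m x with x <? n
  ... | yes _ = ≤-pred (toℕ<n _)
  ... | no _  = z≤n

  start end : ℕ → ℕ
  start = extendℕ (λ j → toℕ (proj₁ (prefix j)))
  end   = extendℕ (λ j → toℕ (proj₁ (proj₂ (prefix j))))

  InPrefix : ℕ → ℕ → Set
  InPrefix j x = start j ≤ x × x ≤ end j

  end<n : ∀ j → j < suc m → end j < n
  end<n j j≤m = subst (_< n) (sym (extendℕ-fromℕ< _ j j≤m)) (toℕ<n _)

  inPrefix⇒<n : ∀ j → j < suc m → ∀ x → InPrefix j x → x < n
  inPrefix⇒<n j j≤m x (_ , x≤end) = ≤-<-trans x≤end (end<n j j≤m)

  module _ j (j≤m : j < suc m) x (x<n : x < n) where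
    private
      Jᶠ = fromℕ< j≤m
      Xᶠ = fromℕ< x<n
      start≡ = extendℕ-fromℕ< (λ j → toℕ (proj₁ (prefix j))) j j≤m
      end≡   = extendℕ-fromℕ< (λ j → toℕ (proj₁ (proj₂ (prefix j)))) j j≤m
      rank≡  = extendℕ-fromℕ< (λ x → toℕ (π ⟨$⟩ˡ f x)) x x<n
      inside = proj₂ (proj₂ (prefix Jᶠ)) Xᶠ

    rank≤⇒inPrefix : rank x ≤ j → InPrefix j x
    rank≤⇒inPrefix rank≤j with Equivalence.to inside
        (π ⟨$⟩ˡ f Xᶠ , subst (_ ≤_) (sym (toℕ-fromℕ< j≤m)) (subst (_≤ j) rank≡ rank≤j) , sym (inverseʳ π))
    ... | a≤x , x≤b = subst (_≤ x) (sym start≡) (subst (_ ≤_) (toℕ-fromℕ< x<n) a≤x) ,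
                      subst (x ≤_) (sym end≡) (subst (_≤ _) (toℕ-fromℕ< x<n) x≤b)

    inPrefix⇒rank≤ : InPrefix j x → rank x ≤ j
    inPrefix⇒rank≤ (a≤x , x≤b) with Equivalence.from inside
        (subst (_ ≤_) (sym (toℕ-fromℕ< x<n)) (subst (_≤ x) start≡ a≤x) ,
         subst (_≤ _) (sym (toℕ-fromℕ< x<n)) (subst (x ≤_) end≡ x≤b))
    ... | i , i≤j , fX≡πi = subst (_≤ j) (sym (trans rank≡ (cong toℕ (trans (cong (π ⟨$⟩ˡ_) fX≡πi) (inverseˡ π)))))
                              (subst (_ ≤_) (toℕ-fromℕ< j≤m) i≤j)

  rank-onto : ∀ j → j < suc m → Σ ℕ λ x → x < n × rank x ≡ j
  rank-onto j j≤m with f-onto (π ⟨$⟩ʳ fromℕ< j≤m)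
  ... | x , fx≡ = toℕ x , toℕ<n x , (begin
    rank (toℕ x)                         ≡⟨ extendℕ-toℕ _ x ⟩
    toℕ (π ⟨$⟩ˡ f x)                      ≡⟨ cong (λ b → toℕ (π ⟨$⟩ˡ b)) fx≡ ⟩
    toℕ (π ⟨$⟩ˡ (π ⟨$⟩ʳ fromℕ< j≤m))      ≡⟨ cong toℕ (inverseˡ π) ⟩
    toℕ (fromℕ< j≤m)                      ≡⟨ toℕ-fromℕ< j≤m ⟩
    j                                    ∎)
    where open ≡-Reasoning

  start≤end : ∀ j → j < suc m → start j ≤ end j
  start≤end j j≤m with rank-onto j j≤m
  ... | x , x<n , rank≡j with rank≤⇒inPrefix j j≤m x x<n (≤-reflexive rank≡j)
  ...   | start≤x , x≤end = ≤-trans start≤x x≤end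

  inPrefix-suc : ∀ j → suc j < suc m → ∀ x → InPrefix j x → InPrefix (suc j) x
  inPrefix-suc j j<m x in-j =
    rank≤⇒inPrefix (suc j) j<m x x<n (m≤n⇒m≤1+n (inPrefix⇒rank≤ j (<-trans (n<1+n j) j<m) x x<n in-j))
    where
    x<n = inPrefix⇒<n j (<-trans (n<1+n j) j<m) x in-j

  start-antitone : ∀ j → suc j < suc m → start (suc j) ≤ start j
  start-antitone j j<m = proj₁ (inPrefix-suc j j<m (start j) (≤-refl , start≤end j (<-trans (n<1+n j) j<m)))

  end-monotone : ∀ j → suc j < suc m → end j ≤ end (suc j)
  end-monotone j j<m = proj₂ (inPrefix-suc j j<m (end j) (start≤end j (<-trans (n<1+n j) j<m) , ≤-refl))

  rank-new : ∀ j → suc j < suc m → ∀ x → InPrefix (suc j) x → ¬ InPrefix j x → rank x ≡ suc j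
  rank-new j j<m x in-j+1 ∉j = ≤-antisym (inPrefix⇒rank≤ (suc j) j<m x x<n in-j+1)
    (≰⇒> λ rank≤j → ∉j (rank≤⇒inPrefix j (<-trans (n<1+n j) j<m) x x<n rank≤j))
    where
    x<n = inPrefix⇒<n (suc j) j<m x in-j+1

  ringLeft ringRight : ℕ → ℕ
  ringLeft j  = start j ∸ start (suc j)
  ringRight j = end (suc j) ∸ end j

  nest : (j : ℕ) → Nest j
  nest zero    = core (suc (end 0) ∸ start 0)
  nest (suc j) = ring (ringLeft j) (ringRight j) (nest j)

  width-nest : ∀ j → j < suc m → width (nest j) ≡ suc (end j) ∸ start j
  width-nest zero    _   = refl
  width-nest (suc j) j<m =
    trans (cong (λ w → ringLeft j + w + ringRight j) (width-nest j j≤m))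
          (∸-telescope (start-antitone j j<m) (start≤end j j≤m) (end-monotone j j<m))
    where
    j≤m = <-trans (n<1+n j) j<m

  nest-proper : ∀ j → j < suc m → Proper (nest j)
  nest-proper zero    0≤m = m<n⇒0<n∸m (s≤s (start≤end 0 0≤m))
  nest-proper (suc j) j<m with rank-onto (suc j) j<m
  ... | x , x<n , rank≡ = ring-nonempty (<⊎≥ x (start j)) , nest-proper j j≤m
    where
    j≤m = <-trans (n<1+n j) j<m
    in-j+1 = rank≤⇒inPrefix (suc j) j<m x x<n (≤-reflexive rank≡)
    ∉j : ¬ InPrefix j x
    ∉j in-j = <-irrefl refl (≤-trans (≤-reflexive (sym rank≡)) (inPrefix⇒rank≤ j j≤m x x<n in-j))
    ring-nonempty : x < start j ⊎ start j ≤ x → 1 ≤ ringLeft j + ringRight j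
    ring-nonempty (inj₁ x<start) = ≤-trans (m<n⇒0<n∸m (≤-<-trans (proj₁ in-j+1) x<start)) (m≤m+n _ _)
    ring-nonempty (inj₂ start≤x) with <⊎≥ (end j) x
    ... | inj₁ end<x = ≤-trans (m<n⇒0<n∸m (<-≤-trans end<x (proj₂ in-j+1))) (m≤n+m _ _)
    ... | inj₂ x≤end = ⊥-elim (∉j (start≤x , x≤end))

  innerStart≡ : ∀ j → suc j < suc m → start (suc j) + ringLeft j ≡ start j
  innerStart≡ j j<m = m+[n∸m]≡n (start-antitone j j<m)

  innerEnd≡ : ∀ j → suc j < suc m → start (suc j) + ringLeft j + width (nest j) ≡ suc (end j)
  innerEnd≡ j j<m = trans (cong₂ _+_ (innerStart≡ j j<m) (width-nest j j≤m)) (m+[n∸m]≡n (m≤n⇒m≤1+n (start≤end j j≤m)))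
    where
    j≤m = <-trans (n<1+n j) j<m

  label-nest : ∀ j → j < suc m → ∀ x → InPrefix j x → label (nest j) (start j) x ≡ rank x
  label-nest zero 0≤m x in-0 = sym (n≤0⇒n≡0 (inPrefix⇒rank≤ 0 0≤m x (inPrefix⇒<n 0 0≤m x in-0) in-0))
  label-nest (suc j) j<m x in-j+1 with interval-trichotomy (start j) (suc (end j)) x
  ... | inj₁ x<start =
    trans (label-left (ringLeft j) (ringRight j) (nest j) (start (suc j)) x (subst (x <_) (sym (innerStart≡ j j<m)) x<start))
          (sym (rank-new j j<m x in-j+1 (λ (start≤x , _) → <⇒≱ x<start start≤x)))
  ... | inj₂ (inj₁ (start≤x , x≤end)) =
    trans (label-middle (ringLeft j) (ringRight j) (nest j) (start (suc j)) x (subst (_≤ x) (sym (innerStart≡ j j<m)) start≤x)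
                                         (subst (x <_) (sym (innerEnd≡ j j<m)) x≤end))
          (trans (cong (λ s → label (nest j) s x) (innerStart≡ j j<m))
                 (label-nest j (<-trans (n<1+n j) j<m) x (start≤x , ≤-pred x≤end)))
  ... | inj₂ (inj₂ end<x) =
    trans (label-right (ringLeft j) (ringRight j) (nest j) (start (suc j)) x (subst (_≤ x) (sym (innerEnd≡ j j<m)) end<x))
          (sym (rank-new j j<m x in-j+1 (λ (_ , x≤end) → <⇒≱ (s≤s x≤end) end<x)))

  module _ (n≥1 : 1 ≤ n) where

    inPrefix-last : ∀ x → x < n → InPrefix m x
    inPrefix-last x x<n = rank≤⇒inPrefix m ≤-refl x x<n (rank≤m x)

    start-last : start m ≡ 0
    start-last = n≤0⇒n≡0 (proj₁ (inPrefix-last 0 n≥1))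

    end-last : suc (end m) ≡ n
    end-last with ≥1⇒≡suc n≥1
    ... | n′ , refl = ≤-antisym (end<n m ≤-refl) (s≤s (proj₂ (inPrefix-last n′ ≤-refl)))

    width-nest-last : width (nest m) ≡ n
    width-nest-last = trans (width-nest m ≤-refl) (cong₂ _∸_ end-last start-last)

    sameBlocks-nest : SameBlocksOn rank (label (nest m) 0) 0 n
    sameBlocks-nest = sameBlocks-relabel (λ u → u)
      (λ x _ x<n → trans (cong (λ s → label (nest m) s x) (sym start-last)) (label-nest m ≤-refl x (inPrefix-last x x<n)))
      (λ _ _ e → e)

-- Bidiagonal matrices as canonical nests

Σ< : ℕ → (ℕ → ℕ) → ℕ
Σ< zero    g = 0
Σ< (suc n) g = g 0 + Σ< n (λ j → g (suc j))

sum-tabulate : ∀ n (h : Fin n → ℕ) (g : ℕ → ℕ) → (∀ i → h i ≡ g (toℕ i)) → sum (tabulate h) ≡ Σ< n g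
sum-tabulate zero    h g h≗g = refl
sum-tabulate (suc n) h g h≗g = cong₂ _+_ (h≗g fzero) (sum-tabulate n (λ i → h (fsuc i)) (λ j → g (suc j)) (λ i → h≗g (fsuc i)))

Σ<-cong : ∀ n g g′ → (∀ j → j < n → g j ≡ g′ j) → Σ< n g ≡ Σ< n g′
Σ<-cong zero    g g′ g≗g′ = refl
Σ<-cong (suc n) g g′ g≗g′ = cong₂ _+_ (g≗g′ 0 (s≤s z≤n)) (Σ<-cong n _ _ (λ j j<n → g≗g′ (suc j) (s≤s j<n)))

Σ<-zero : ∀ n g → (∀ j → g j ≡ 0) → Σ< n g ≡ 0
Σ<-zero zero    g g≗0 = refl
Σ<-zero (suc n) g g≗0 = cong₂ _+_ (g≗0 0) (Σ<-zero n _ (λ j → g≗0 (suc j)))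

Σ<-suc : ∀ n g → Σ< (suc n) g ≡ Σ< n g + g n
Σ<-suc zero    g = +-comm (g 0) 0
Σ<-suc (suc n) g = trans (cong (g 0 +_) (Σ<-suc n (λ j → g (suc j)))) (sym (+-assoc (g 0) _ _))

-- The last hypothesis covers a + 1 = n, when g (a + 1) lies outside the sum.
Σ<-adjacent : ∀ n g a → (∀ j → j ≢ a → j ≢ suc a → g j ≡ 0) → a < n → (n ≡ suc a → g (suc a) ≡ 0) →
  Σ< n g ≡ g a + g (suc a)
Σ<-adjacent (suc zero) g zero _ _ last = cong (g 0 +_) (sym (last refl))
Σ<-adjacent (suc (suc n)) g zero off _ _ =
  cong (g 0 +_) (trans (cong (g 1 +_) (Σ<-zero n _ (λ j → off (suc (suc j)) (λ ()) (λ ())))) (+-identityʳ (g 1)))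
Σ<-adjacent (suc n) g (suc a) off (s≤s a<n) last =
  trans (cong (_+ Σ< n (λ j → g (suc j))) (off 0 (λ ()) (λ ())))
        (Σ<-adjacent n (λ j → g (suc j)) a (λ j j≢a j≢a+1 → off (suc j) (j≢a ∘ suc-injective) (j≢a+1 ∘ suc-injective))
          a<n (λ n≡ → last (cong suc n≡)))
ring-cong : ∀ {m} {l l′ r r′ : ℕ} {c c′ : Nest m} → l ≡ l′ → r ≡ r′ → c ≡ c′ → ring l r c ≡ ring l′ r′ c′
ring-cong refl refl refl = refl

leftWidth rightWidth : ∀ {j} → Nest j → ℕ → ℕ
leftWidth (core _) i = 0
leftWidth {suc j} (ring l r c) i with i ≟ j
... | yes _ = l
... | no _  = leftWidth c i
rightWidth (core _) i = 0
rightWidth {suc j} (ring l r c) i with i ≟ j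
... | yes _ = r
... | no _  = rightWidth c i

coreWidth : ∀ {j} → Nest j → ℕ
coreWidth (core s)     = s
coreWidth (ring _ _ c) = coreWidth c

module _ {j} (l r : ℕ) (c : Nest j) where

  leftWidth-top : leftWidth (ring l r c) j ≡ l
  leftWidth-top with j ≟ j
  ... | yes _ = refl
  ... | no j≢j = ⊥-elim (j≢j refl)

  rightWidth-top : rightWidth (ring l r c) j ≡ r
  rightWidth-top with j ≟ j
  ... | yes _ = refl
  ... | no j≢j = ⊥-elim (j≢j refl)

  leftWidth-inner : ∀ i → i ≢ j → leftWidth (ring l r c) i ≡ leftWidth c i
  leftWidth-inner i i≢j with i ≟ j
  ... | yes i≡j = ⊥-elim (i≢j i≡j)
  ... | no _ = refl

  rightWidth-inner : ∀ i → i ≢ j → rightWidth (ring l r c) i ≡ rightWidth c i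
  rightWidth-inner i i≢j with i ≟ j
  ... | yes i≡j = ⊥-elim (i≢j i≡j)
  ... | no _ = refl

nest-ext : ∀ {j} (c c′ : Nest j) →
  (∀ i → i < j → leftWidth c i ≡ leftWidth c′ i × rightWidth c i ≡ rightWidth c′ i) →
  coreWidth c ≡ coreWidth c′ → c ≡ c′
nest-ext (core s) (core s′) _ s≡ = cong core s≡
nest-ext (ring l r c) (ring l′ r′ c′) widths≡ core≡ =
  ring-cong (trans (sym (leftWidth-top l r c)) (trans (proj₁ (widths≡ _ ≤-refl)) (leftWidth-top l′ r′ c′)))
            (trans (sym (rightWidth-top l r c)) (trans (proj₂ (widths≡ _ ≤-refl)) (rightWidth-top l′ r′ c′)))
    (nest-ext c c′ (λ i i<j → let i≢j = <⇒≢ i<j in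
        trans (sym (leftWidth-inner l r c i i≢j)) (trans (proj₁ (widths≡ i (m<n⇒m<1+n i<j))) (leftWidth-inner l′ r′ c′ i i≢j)) ,
        trans (sym (rightWidth-inner l r c i i≢j)) (trans (proj₂ (widths≡ i (m<n⇒m<1+n i<j))) (rightWidth-inner l′ r′ c′ i i≢j)))
      core≡)

coreWidth-pos : ∀ {j} (c : Nest j) → Proper c → 1 ≤ coreWidth c
coreWidth-pos (core s)     p       = p
coreWidth-pos (ring l r c) (_ , p) = coreWidth-pos c p

ringWidth-pos : ∀ {j} (c : Nest j) → Proper c → ∀ i → i < j → 1 ≤ leftWidth c i + rightWidth c i
ringWidth-pos (ring {j} l r c) (l+r≥1 , p) i i<j+1 with toSum (i ≟ j)
... | inj₁ refl = subst (1 ≤_) (sym (cong₂ _+_ (leftWidth-top l r c) (rightWidth-top l r c))) l+r≥1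
... | inj₂ i≢j  = subst (1 ≤_) (sym (cong₂ _+_ (leftWidth-inner l r c i i≢j) (rightWidth-inner l r c i i≢j)))
                    (ringWidth-pos c p i (≤∧≢⇒< (≤-pred i<j+1) i≢j))

innermostLeft-pos : ∀ {j} (c : Nest j) → Canonical c → 0 < j → 1 ≤ leftWidth c 0
innermostLeft-pos (ring {zero} l r (core s)) (_ , _ , opens) _ =
  subst (1 ≤_) (sym (leftWidth-top l r (core s))) (n≢0⇒n>0 opens)
innermostLeft-pos (ring {suc j} l r c) (_ , can , _) _ =
  subst (1 ≤_) (sym (leftWidth-inner l r c 0 (λ ()))) (innermostLeft-pos c can (s≤s z≤n))

-- Column i + 1 of the matrix meets the rings of depths i + 1 and i + 2.
column-pos : ∀ {j} (c : Nest j) → Canonical c → ∀ i → suc i < j → 1 ≤ rightWidth c i + leftWidth c (suc i)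
column-pos (ring {j} l r c) (l+r≥1 , can , opens) i i+1<j+1 with toSum (suc i ≟ j)
... | inj₂ i+1≢j = subst (1 ≤_) (sym (cong₂ _+_ (rightWidth-inner l r c i (<⇒≢ (≤-pred i+1<j+1)))
                                               (leftWidth-inner l r c (suc i) i+1≢j)))
                     (column-pos c can i (≤∧≢⇒< (≤-pred i+1<j+1) i+1≢j))
column-pos (ring {suc i} (suc l) r c) _ i _ | inj₁ refl =
  subst (1 ≤_) (sym (cong (rightWidth (ring (suc l) r c) i +_) (leftWidth-top (suc l) r c))) (≤-trans (s≤s z≤n) (m≤n+m (suc l) _))
column-pos (ring {suc i} zero r (ring l₂ r₂ c₂)) (_ , _ , opens) i _ | inj₁ refl =
  subst (1 ≤_) (sym (cong₂ _+_ (trans (rightWidth-inner 0 r (ring l₂ r₂ c₂) i (<⇒≢ (n<1+n i))) (rightWidth-top l₂ r₂ c₂))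
                               (leftWidth-top 0 r (ring l₂ r₂ c₂))))
    (≤-trans (opens refl) (m≤m+n r₂ 0))

m+n>0⇒m≢0⊎n≢0 : ∀ {m n} → 1 ≤ m + n → m ≢ 0 ⊎ n ≢ 0
m+n>0⇒m≢0⊎n≢0 {zero}  p = inj₂ (λ n≡0 → <-irrefl (sym n≡0) p)
m+n>0⇒m≢0⊎n≢0 {suc m} _ = inj₁ (λ ())

module BandMatrix (m : ℕ) where

  entryℕ : Mat (suc m) → ℕ → ℕ → ℕ
  entryℕ M i j = extendℕ (λ I → extendℕ (M I) j) i

  entryℕ-toℕ : ∀ M I J → entryℕ M (toℕ I) (toℕ J) ≡ M I J
  entryℕ-toℕ M I J = trans (extendℕ-toℕ _ I) (extendℕ-toℕ (M I) J)

  entryℕ-fromℕ< : ∀ M i j (i<k : i < suc m) (j<k : j < suc m) → entryℕ M i j ≡ M (fromℕ< i<k) (fromℕ< j<k)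
  entryℕ-fromℕ< M i j i<k j<k = trans (extendℕ-fromℕ< _ i i<k) (extendℕ-fromℕ< _ j j<k)

  entryℕ-≥ : ∀ M i j → suc m ≤ j → entryℕ M i j ≡ 0
  entryℕ-≥ M i j k≤j = extendℕ-zero _ (λ I → extendℕ-≥ (M I) j k≤j) i

  entryℕ-cong : ∀ {M N} → (∀ I J → M I J ≡ N I J) → ∀ i j → entryℕ M i j ≡ entryℕ N i j
  entryℕ-cong M≗N i j = extendℕ-cong (λ I → extendℕ-cong (M≗N I) j) i

  entryℕ-offBand : ∀ M → Bidiagonal M → ∀ i j → j ≢ i → j ≢ suc i → entryℕ M i j ≡ 0
  entryℕ-offBand M bd i j j≢i j≢i+1 with <⊎≥ i (suc m) | <⊎≥ j (suc m)
  ... | inj₁ i<k | inj₁ j<k = trans (entryℕ-fromℕ< M i j i<k j<k)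
    (bd _ _ (λ e → j≢i (trans (sym (toℕ-fromℕ< j<k)) (trans e (toℕ-fromℕ< i<k))))
            (λ e → j≢i+1 (trans (sym (toℕ-fromℕ< j<k)) (trans e (cong suc (toℕ-fromℕ< i<k))))))
  ... | inj₁ _   | inj₂ k≤j = entryℕ-≥ M i j k≤j
  ... | inj₂ k≤i | _        = extendℕ-≥ _ i k≤i

  -- Row i < m of the matrix is the ring of depth i + 1; the entry (m, m) is the core.
  nestUpTo : Mat (suc m) → (j : ℕ) → Nest j
  nestUpTo M zero    = core (entryℕ M m m)
  nestUpTo M (suc j) = ring (entryℕ M j j) (entryℕ M j (suc j)) (nestUpTo M j)

  nestOf : Mat (suc m) → Nest m
  nestOf M = nestUpTo M m

  nestUpTo-cong : ∀ {M N} → (∀ I J → M I J ≡ N I J) → ∀ j → nestUpTo M j ≡ nestUpTo N j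
  nestUpTo-cong M≗N zero    = cong core (entryℕ-cong M≗N m m)
  nestUpTo-cong M≗N (suc j) = ring-cong (entryℕ-cong M≗N j j) (entryℕ-cong M≗N j (suc j)) (nestUpTo-cong M≗N j)

  rowSum : Mat (suc m) → ℕ → ℕ
  rowSum M i = entryℕ M i i + entryℕ M i (suc i)

  width-nestUpTo : ∀ M j → width (nestUpTo M j) ≡ Σ< j (rowSum M) + entryℕ M m m
  width-nestUpTo M zero    = refl
  width-nestUpTo M (suc j) = begin
    entryℕ M j j + width (nestUpTo M j) + entryℕ M j (suc j)
      ≡⟨ cong (λ w → entryℕ M j j + w + entryℕ M j (suc j)) (width-nestUpTo M j) ⟩
    entryℕ M j j + (Σ< j (rowSum M) + entryℕ M m m) + entryℕ M j (suc j)
      ≡⟨ regroup (entryℕ M j j) (Σ< j (rowSum M)) (entryℕ M m m) (entryℕ M j (suc j)) ⟩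
    Σ< j (rowSum M) + rowSum M j + entryℕ M m m
      ≡⟨ cong (_+ entryℕ M m m) (sym (Σ<-suc j (rowSum M))) ⟩
    Σ< (suc j) (rowSum M) + entryℕ M m m ∎
    where
    open ≡-Reasoning
    regroup : ∀ a s c b → a + (s + c) + b ≡ s + (a + b) + c
    regroup = solve-∀

  entrySum-bidiagonal : ∀ M → Bidiagonal M → entrySum M ≡ width (nestOf M)
  entrySum-bidiagonal M bd = begin
    entrySum M
      ≡⟨ sum-tabulate (suc m) _ (λ i → Σ< (suc m) (entryℕ M i))
           (λ I → sum-tabulate (suc m) _ (entryℕ M (toℕ I)) (λ J → sym (entryℕ-toℕ M I J))) ⟩
    Σ< (suc m) (λ i → Σ< (suc m) (entryℕ M i))
      ≡⟨ Σ<-cong (suc m) _ (rowSum M) (λ i i<k → Σ<-adjacent (suc m) (entryℕ M i) i (entryℕ-offBand M bd i) i<k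
                                             (λ k≡ → entryℕ-≥ M i (suc i) (≤-reflexive k≡))) ⟩
    Σ< (suc m) (rowSum M)
      ≡⟨ Σ<-suc m (rowSum M) ⟩
    Σ< m (rowSum M) + (entryℕ M m m + entryℕ M m (suc m))
      ≡⟨ cong (λ e → Σ< m (rowSum M) + (entryℕ M m m + e)) (entryℕ-≥ M m (suc m) ≤-refl) ⟩
    Σ< m (rowSum M) + (entryℕ M m m + 0)
      ≡⟨ cong (Σ< m (rowSum M) +_) (+-identityʳ _) ⟩
    Σ< m (rowSum M) + entryℕ M m m
      ≡⟨ sym (width-nestUpTo M m) ⟩
    width (nestOf M) ∎
    where open ≡-Reasoning

  nestUpTo-widths : ∀ M j → ∀ i → i < j →
    leftWidth (nestUpTo M j) i ≡ entryℕ M i i × rightWidth (nestUpTo M j) i ≡ entryℕ M i (suc i)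
  nestUpTo-widths M (suc j) i i<j+1 with toSum (i ≟ j)
  ... | inj₁ refl = leftWidth-top (entryℕ M i i) (entryℕ M i (suc i)) (nestUpTo M i) ,
                    rightWidth-top (entryℕ M i i) (entryℕ M i (suc i)) (nestUpTo M i)
  ... | inj₂ i≢j = trans (leftWidth-inner (entryℕ M j j) (entryℕ M j (suc j)) (nestUpTo M j) i i≢j)
                         (proj₁ (nestUpTo-widths M j i i<j)) ,
                   trans (rightWidth-inner (entryℕ M j j) (entryℕ M j (suc j)) (nestUpTo M j) i i≢j)
                         (proj₂ (nestUpTo-widths M j i i<j))
    where
    i<j = ≤∧≢⇒< (≤-pred i<j+1) i≢j

  coreWidth-nestUpTo : ∀ M j → coreWidth (nestUpTo M j) ≡ entryℕ M m m
  coreWidth-nestUpTo M zero    = refl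
  coreWidth-nestUpTo M (suc j) = coreWidth-nestUpTo M j

  bandEntry : Nest m → ℕ → ℕ → ℕ
  bandEntry c i j with j ≟ i | i ≟ m | j ≟ suc i
  ... | yes _ | yes _ | _     = coreWidth c
  ... | yes _ | no _  | _     = leftWidth c i
  ... | no _  | _     | yes _ = rightWidth c i
  ... | no _  | _     | no _  = 0

  bandEntry-core : ∀ c → bandEntry c m m ≡ coreWidth c
  bandEntry-core c with m ≟ m | m ≟ m
  ... | yes _   | yes _   = refl
  ... | yes _   | no m≢m  = ⊥-elim (m≢m refl)
  ... | no m≢m  | _       = ⊥-elim (m≢m refl)

  bandEntry-diagonal : ∀ c i → i ≢ m → bandEntry c i i ≡ leftWidth c i
  bandEntry-diagonal c i i≢m with i ≟ i | i ≟ m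
  ... | yes _  | yes i≡m = ⊥-elim (i≢m i≡m)
  ... | yes _  | no _    = refl
  ... | no i≢i | _       = ⊥-elim (i≢i refl)

  bandEntry-superdiagonal : ∀ c i → bandEntry c i (suc i) ≡ rightWidth c i
  bandEntry-superdiagonal c i with suc i ≟ i | suc i ≟ suc i
  ... | yes i+1≡i | _ = ⊥-elim (<-irrefl (sym i+1≡i) (n<1+n i))
  ... | no _ | yes _ = refl
  ... | no _ | no ≢  = ⊥-elim (≢ refl)

  bandEntry-off : ∀ c i j → j ≢ i → j ≢ suc i → bandEntry c i j ≡ 0
  bandEntry-off c i j j≢i j≢i+1 with j ≟ i | j ≟ suc i
  ... | yes j≡i | _ = ⊥-elim (j≢i j≡i)
  ... | no _ | yes j≡i+1 = ⊥-elim (j≢i+1 j≡i+1)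
  ... | no _ | no _ = refl

  matrixOf : Nest m → Mat (suc m)
  matrixOf c I J = bandEntry c (toℕ I) (toℕ J)

  matrixOf-bidiagonal : ∀ c → Bidiagonal (matrixOf c)
  matrixOf-bidiagonal c I J = bandEntry-off c (toℕ I) (toℕ J)

  entryℕ-matrixOf : ∀ c i j → i < suc m → j < suc m → entryℕ (matrixOf c) i j ≡ bandEntry c i j
  entryℕ-matrixOf c i j i<k j<k =
    trans (entryℕ-fromℕ< (matrixOf c) i j i<k j<k) (cong₂ (bandEntry c) (toℕ-fromℕ< i<k) (toℕ-fromℕ< j<k))

  nestOf-matrixOf : ∀ c → nestOf (matrixOf c) ≡ c
  nestOf-matrixOf c = nest-ext (nestOf (matrixOf c)) c
    (λ i i<m → let i<k = m<n⇒m<1+n i<m ; widths = nestUpTo-widths (matrixOf c) m i i<m in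
      trans (proj₁ widths) (trans (entryℕ-matrixOf c i i i<k i<k) (bandEntry-diagonal c i (<⇒≢ i<m))) ,
      trans (proj₂ widths) (trans (entryℕ-matrixOf c i (suc i) i<k (s≤s i<m)) (bandEntry-superdiagonal c i)))
    (trans (coreWidth-nestUpTo (matrixOf c) m) (trans (entryℕ-matrixOf c m m ≤-refl ≤-refl) (bandEntry-core c)))

  matrixOf-nestOf : ∀ M → Bidiagonal M → ∀ I J → matrixOf (nestOf M) I J ≡ M I J
  matrixOf-nestOf M bd I J = trans (bandEntry≡entry (toℕ I) (toℕ J) (toℕ<n I) (toℕ<n J)) (entryℕ-toℕ M I J)
    where
    c = nestOf M
    bandEntry≡entry : ∀ i j → i < suc m → j < suc m → bandEntry c i j ≡ entryℕ M i j
    bandEntry≡entry i j i<k j<k with toSum (j ≟ i) | toSum (j ≟ suc i)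
    ... | inj₁ refl | _ with toSum (j ≟ m)
    ...   | inj₁ refl = trans (bandEntry-core c) (coreWidth-nestUpTo M m)
    ...   | inj₂ j≢m  = trans (bandEntry-diagonal c j j≢m) (proj₁ (nestUpTo-widths M m j (≤∧≢⇒< (≤-pred i<k) j≢m)))
    bandEntry≡entry i j i<k j<k | inj₂ j≢i | inj₁ refl =
      trans (bandEntry-superdiagonal c i) (proj₂ (nestUpTo-widths M m i (≤-pred j<k)))
    bandEntry≡entry i j i<k j<k | inj₂ j≢i | inj₂ j≢i+1 =
      trans (bandEntry-off c i j j≢i j≢i+1) (sym (entryℕ-offBand M bd i j j≢i j≢i+1))

  finOf : ∀ i → i < suc m → Σ (Fin (suc m)) λ I → toℕ I ≡ i
  finOf i i<k = fromℕ< i<k , toℕ-fromℕ< i<k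

  module _ {n} (M : Mat (suc m)) (bd : Bidiagonal M) (M∈Int : InInt n M) where

    private
      entry≢0 : ∀ I J {i j} → toℕ I ≡ i → toℕ J ≡ j → M I J ≢ 0 → entryℕ M i j ≢ 0
      entry≢0 I J refl refl M≢0 e = M≢0 (trans (sym (entryℕ-toℕ M I J)) e)

    rowSum-pos : ∀ i → i < suc m → 1 ≤ rowSum M i
    rowSum-pos i i<k with finOf i i<k
    ... | I , refl with proj₁ (proj₂ (proj₂ M∈Int)) I
    ...   | J , M≢0 with toSum (toℕ J ≟ toℕ I) | toSum (toℕ J ≟ suc (toℕ I))
    ...     | inj₁ J≡I | _ = ≤-trans (n≢0⇒n>0 (entry≢0 I J refl J≡I M≢0)) (m≤m+n _ _)
    ...     | inj₂ _ | inj₁ J≡I+1 = ≤-trans (n≢0⇒n>0 (entry≢0 I J refl J≡I+1 M≢0)) (m≤n+m _ _)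
    ...     | inj₂ J≢I | inj₂ J≢I+1 = ⊥-elim (M≢0 (bd I J J≢I J≢I+1))

    column-nonzero : ∀ j → j < suc m → entryℕ M j j ≢ 0 ⊎ Σ ℕ λ i → j ≡ suc i × entryℕ M i j ≢ 0
    column-nonzero j j<k with finOf j j<k
    ... | J , refl with proj₂ (proj₂ (proj₂ M∈Int)) J
    ...   | I , M≢0 with toSum (toℕ J ≟ toℕ I) | toSum (toℕ J ≟ suc (toℕ I))
    ...     | inj₁ J≡I | _ = inj₁ (entry≢0 I J (sym J≡I) refl M≢0)
    ...     | inj₂ _ | inj₁ J≡I+1 = inj₂ (toℕ I , J≡I+1 , entry≢0 I J refl refl M≢0)
    ...     | inj₂ J≢I | inj₂ J≢I+1 = ⊥-elim (M≢0 (bd I J J≢I J≢I+1))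

    opensRight-nestUpTo : ∀ j → j < suc m → entryℕ M j j ≡ 0 → OpensRight (nestUpTo M j)
    opensRight-nestUpTo j j<k M≡0 with column-nonzero j j<k
    ... | inj₁ M≢0 = ⊥-elim (M≢0 M≡0)
    ... | inj₂ (i , refl , M≢0) = n≢0⇒n>0 M≢0

    canonical-nestUpTo : ∀ j → j ≤ m → Canonical (nestUpTo M j)
    canonical-nestUpTo zero    _ =
      subst (1 ≤_) (trans (cong (entryℕ M m m +_) (entryℕ-≥ M m (suc m) ≤-refl)) (+-identityʳ _)) (rowSum-pos m ≤-refl)
    canonical-nestUpTo (suc j) j<m =
      rowSum-pos j (m<n⇒m<1+n j<m) , canonical-nestUpTo j (<⇒≤ j<m) , opensRight-nestUpTo j (m<n⇒m<1+n j<m)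

    canonical-nestOf : Canonical (nestOf M)
    canonical-nestOf = canonical-nestUpTo m ≤-refl

    width-nestOf : width (nestOf M) ≡ n
    width-nestOf = trans (sym (entrySum-bidiagonal M bd)) (proj₁ (proj₂ M∈Int))

  module _ {n} (c : Nest m) (can : Canonical c) (w≡ : width c ≡ n) where

    private
      nonzero : ∀ {a} → 1 ≤ a → a ≢ 0
      nonzero a≥1 a≡0 = <-irrefl (sym a≡0) a≥1

      diagonal≡ : ∀ {I J} → toℕ I ≡ toℕ J → toℕ I ≢ m → matrixOf c I J ≡ leftWidth c (toℕ I)
      diagonal≡ {I} I≡J I≢m = trans (cong (bandEntry c (toℕ I)) (sym I≡J)) (bandEntry-diagonal c (toℕ I) I≢m)

      core≡ : ∀ {I J} → toℕ I ≡ m → toℕ J ≡ m → matrixOf c I J ≡ coreWidth c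
      core≡ I≡m J≡m = trans (cong₂ (bandEntry c) I≡m J≡m) (bandEntry-core c)

      superdiagonal≡ : ∀ {I J} → toℕ J ≡ suc (toℕ I) → matrixOf c I J ≡ rightWidth c (toℕ I)
      superdiagonal≡ {I} J≡I+1 = trans (cong (bandEntry c (toℕ I)) J≡I+1) (bandEntry-superdiagonal c (toℕ I))

      core-pos = coreWidth-pos c (Canonical⇒Proper c can)

    matrixOf-upperTriangular : UpperTriangular (matrixOf c)
    matrixOf-upperTriangular I J J<I = bandEntry-off c (toℕ I) (toℕ J) (<⇒≢ J<I) (<⇒≢ (m<n⇒m<1+n J<I))

    entrySum-matrixOf : entrySum (matrixOf c) ≡ n
    entrySum-matrixOf = trans (entrySum-bidiagonal (matrixOf c) (matrixOf-bidiagonal c)) (trans (cong width (nestOf-matrixOf c)) w≡)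

    matrixOf-rows : ∀ I → ∃ λ J → matrixOf c I J ≢ 0
    matrixOf-rows I with toSum (toℕ I ≟ m)
    ... | inj₁ I≡m = I , λ e → nonzero core-pos (trans (sym (core≡ I≡m I≡m)) e)
    ... | inj₂ I≢m with m+n>0⇒m≢0⊎n≢0 (ringWidth-pos c (Canonical⇒Proper c can) (toℕ I) I<m)
      where I<m = ≤∧≢⇒< (≤-pred (toℕ<n I)) I≢m
    ...   | inj₁ left≢0 = I , λ e → left≢0 (trans (sym (diagonal≡ refl I≢m)) e)
    ...   | inj₂ right≢0 with finOf (suc (toℕ I)) (s≤s (≤∧≢⇒< (≤-pred (toℕ<n I)) I≢m))
    ...     | J , J≡I+1 = J , λ e → right≢0 (trans (sym (superdiagonal≡ J≡I+1)) e)

    matrixOf-columns : ∀ J → ∃ λ I → matrixOf c I J ≢ 0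
    matrixOf-columns J with toSum (toℕ J ≟ m)
    ... | inj₁ J≡m = J , λ e → nonzero core-pos (trans (sym (core≡ J≡m J≡m)) e)
    ... | inj₂ J≢m = column (toℕ J) refl (≤∧≢⇒< (≤-pred (toℕ<n J)) J≢m)
      where
      column : ∀ j → toℕ J ≡ j → j < m → ∃ λ I → matrixOf c I J ≢ 0
      column zero J≡0 0<m =
        J , λ e → nonzero (innermostLeft-pos c can 0<m) (trans (sym (trans (diagonal≡ refl J≢m) (cong (leftWidth c) J≡0))) e)
      column (suc i) J≡i+1 i+1<m with m+n>0⇒m≢0⊎n≢0 (column-pos c can i i+1<m)
      ... | inj₂ left≢0 = J , λ e → left≢0 (trans (sym (trans (diagonal≡ refl J≢m) (cong (leftWidth c) J≡i+1))) e)
      ... | inj₁ right≢0 with finOf i (<-trans (n<1+n i) (m<n⇒m<1+n i+1<m))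
      ...   | I , refl = I , λ e → right≢0 (trans (sym (superdiagonal≡ J≡i+1)) e)

    matrixOf-inInt : InInt n (matrixOf c)
    matrixOf-inInt = matrixOf-upperTriangular , entrySum-matrixOf , matrixOf-rows , matrixOf-columns

sameBlocks-fromFin : ∀ {n} {g h : ℕ → ℕ} → (∀ (x y : Fin n) → (g (toℕ x) ≡ g (toℕ y)) ⇔ (h (toℕ x) ≡ h (toℕ y))) →
  SameBlocksOn g h 0 n
sameBlocks-fromFin {g = g} {h} same x y _ x<n _ y<n =
  subst₂ (λ a b → (g a ≡ g b → h a ≡ h b) × (h a ≡ h b → g a ≡ g b)) (toℕ-fromℕ< x<n) (toℕ-fromℕ< y<n)
    (Equivalence.to (same (fromℕ< x<n) (fromℕ< y<n)) , Equivalence.from (same (fromℕ< x<n) (fromℕ< y<n)))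

module _ {n m : ℕ} where

  blocksOf : Nest m → Fin n → Fin (suc m)
  blocksOf c x = fromℕ< (s≤s (label≤depth c 0 (toℕ x)))

  toℕ-blocksOf : ∀ c x → toℕ (blocksOf c x) ≡ label c 0 (toℕ x)
  toℕ-blocksOf c x = toℕ-fromℕ< (s≤s (label≤depth c 0 (toℕ x)))

  blocksOf-sameBlock : ∀ c x y → (blocksOf c x ≡ blocksOf c y) ⇔ (label c 0 (toℕ x) ≡ label c 0 (toℕ y))
  blocksOf-sameBlock c x y = mk⇔
    (λ e → trans (sym (toℕ-blocksOf c x)) (trans (cong toℕ e) (toℕ-blocksOf c y)))
    (λ e → toℕ-injective (trans (toℕ-blocksOf c x) (trans e (sym (toℕ-blocksOf c y)))))

  module _ (c : Nest m) (p : Proper c) (w≡ : width c ≡ n) where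

    blocksOf-onto : SurjectiveMap (blocksOf c)
    blocksOf-onto b with label-onto c p 0 (toℕ b) (≤-pred (toℕ<n b))
    ... | x , _ , x<w , label≡b = fromℕ< x<n , toℕ-injective (begin
      toℕ (blocksOf c (fromℕ< x<n))     ≡⟨ toℕ-blocksOf c (fromℕ< x<n) ⟩
      label c 0 (toℕ (fromℕ< x<n))      ≡⟨ cong (label c 0) (toℕ-fromℕ< x<n) ⟩
      label c 0 x                       ≡⟨ label≡b ⟩
      toℕ b                             ∎)
      where
      open ≡-Reasoning
      x<n = subst (x <_) w≡ x<w

    blocksOf-orderConsecutive : OrderConsecutive (blocksOf c)
    blocksOf-orderConsecutive = Permutation.id , λ j → prefixAt j (prefixInterval-label c p 0 (toℕ j))
      where
      prefixAt : ∀ j → PrefixInterval (label c 0) 0 (width c) (toℕ j) → Σ (Fin n) λ a → Σ (Fin n) λ b → ∀ x →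
        (Σ (Fin (suc m)) λ i → toℕ i ≤ toℕ j × blocksOf c x ≡ Permutation.id ⟨$⟩ʳ i)
          ⇔ (toℕ a ≤ toℕ x × toℕ x ≤ toℕ b)
      prefixAt j (prefixInterval {a} {b} _ a≤b b<w inside) = fromℕ< a<n , fromℕ< b<n , λ x →
        let x<w = subst (toℕ x <_) (sym w≡) (toℕ<n x)
            label≤j⇔ = inside (toℕ x) z≤n x<w in
        mk⇔ (λ (i , i≤j , x∈i) →
               let (a≤x , x≤b) = Equivalence.to label≤j⇔
                                   (subst (_≤ toℕ j) (trans (cong toℕ (sym x∈i)) (toℕ-blocksOf c x)) i≤j)
               in subst (_≤ toℕ x) (sym (toℕ-fromℕ< a<n)) a≤x , subst (toℕ x ≤_) (sym (toℕ-fromℕ< b<n)) x≤b)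
            (λ (a≤x , x≤b) →
               blocksOf c x ,
               subst (_≤ toℕ j) (sym (toℕ-blocksOf c x))
                 (Equivalence.from label≤j⇔
                   (subst (_≤ toℕ x) (toℕ-fromℕ< a<n) a≤x , subst (toℕ x ≤_) (toℕ-fromℕ< b<n) x≤b)) ,
               refl)
        where
        b<n = subst (b <_) w≡ b<w
        a<n = ≤-<-trans a≤b b<n

  samePartition⇒sameBlocks : ∀ c c′ → width c ≡ n → SamePartition (blocksOf c) (blocksOf c′) →
    SameBlocksOn (label c 0) (label c′ 0) 0 (width c)
  samePartition⇒sameBlocks c c′ w≡ same = subst (SameBlocksOn _ _ 0) (sym w≡) (sameBlocks-fromFin λ x y →
    ⇔.trans (⇔.sym (blocksOf-sameBlock c x y)) (⇔.trans (same x y) (blocksOf-sameBlock c′ x y)))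

samePartition-≡ : ∀ {n m} {c c′ : Nest m} → c ≡ c′ → SamePartition {n} (blocksOf c) (blocksOf c′)
samePartition-≡ refl x y = ⇔.refl

module Correspondence (n m : ℕ) where
  open BandMatrix m

  Matrix Partition : Set
  Matrix    = Σ (Mat (suc m)) λ M → InInt n M × Bidiagonal M
  Partition = Σ (Fin n → Fin (suc m)) λ f → SurjectiveMap f × OrderConsecutive f

  partitionOf : Matrix → Partition
  partitionOf (M , M∈Int , bd) = blocksOf c , blocksOf-onto c p w≡ , blocksOf-orderConsecutive c p w≡
    where
    c = nestOf M
    p = Canonical⇒Proper c (canonical-nestOf M bd M∈Int)
    w≡ = width-nestOf M bd M∈Int

  partitionOf-cong : ∀ {A B : Matrix} → (∀ I J → proj₁ A I J ≡ proj₁ B I J) →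
    SamePartition (blocksOf {n} (nestOf (proj₁ A))) (blocksOf (nestOf (proj₁ B)))
  partitionOf-cong A≗B = samePartition-≡ (nestUpTo-cong A≗B m)

  partitionOf-injective : ∀ {A B : Matrix} → SamePartition (blocksOf {n} (nestOf (proj₁ A))) (blocksOf (nestOf (proj₁ B))) →
    ∀ I J → proj₁ A I J ≡ proj₁ B I J
  partitionOf-injective {M , M∈Int , bdM} {N , N∈Int , bdN} same I J = begin
    M I J                        ≡⟨ sym (matrixOf-nestOf M bdM I J) ⟩
    matrixOf (nestOf M) I J      ≡⟨ cong (λ c → matrixOf c I J) nests≡ ⟩
    matrixOf (nestOf N) I J      ≡⟨ matrixOf-nestOf N bdN I J ⟩
    N I J                        ∎
    where
    open ≡-Reasoning
    wM = width-nestOf M bdM M∈Int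
    nests≡ : nestOf M ≡ nestOf N
    nests≡ = canonical-unique (nestOf M) (nestOf N) (canonical-nestOf M bdM M∈Int) (canonical-nestOf N bdN N∈Int)
               (trans wM (sym (width-nestOf N bdN N∈Int))) 0 (samePartition⇒sameBlocks (nestOf M) (nestOf N) wM same)

  module _ (n≥1 : 1 ≤ n) (f : Fin n → Fin (suc m)) (f-onto : SurjectiveMap f) (oc : OrderConsecutive f) where
    open OrderedPrefixes f f-onto oc
    open CanonicalForm (canonicalise (nest m) (nest-proper m ≤-refl)) renaming (nest to c)

    width-c : width c ≡ n
    width-c = trans width≡ (width-nest-last n≥1)

    sameBlocks-rank : SameBlocksOn rank (label c 0) 0 n
    sameBlocks-rank = sameBlocks-trans (sameBlocks-nest n≥1) (subst (SameBlocksOn _ _ 0) (width-nest-last n≥1) (sameBlocks 0))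

    samePartition-c : SamePartition (blocksOf c) f
    samePartition-c x y = ⇔.trans (blocksOf-sameBlock c x y) (⇔.trans (mk⇔ (proj₂ same) (proj₁ same)) (rank-sameBlock x y))
      where same = sameBlocks-rank (toℕ x) (toℕ y) z≤n (toℕ<n x) z≤n (toℕ<n y)

    matrixOf-c : Matrix
    matrixOf-c = matrixOf c , matrixOf-inInt c canonical width-c , matrixOf-bidiagonal c

    partitionOf-matrixOf-c : ∀ {B : Matrix} → (∀ I J → proj₁ B I J ≡ proj₁ matrixOf-c I J) →
      SamePartition (blocksOf (nestOf (proj₁ B))) f
    partitionOf-matrixOf-c B≗ =
      subst (λ d → SamePartition (blocksOf d) f) (sym (trans (nestUpTo-cong B≗ m) (nestOf-matrixOf c))) samePartition-c

mainTheorem13 : (n k : ℕ) → 1 ≤ n → 1 ≤ k → Bijection (BidiagInt n k) (OCPartition n k)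
mainTheorem13 n zero    _   ()
mainTheorem13 n (suc m) n≥1 _ = record
  { to        = partitionOf
  ; cong      = λ {A} {B} → partitionOf-cong {A} {B}
  ; bijective = (λ {A} {B} → partitionOf-injective {A} {B}) ,
                λ (f , f-onto , oc) → matrixOf-c n≥1 f f-onto oc , λ {B} → partitionOf-matrixOf-c n≥1 f f-onto oc {B}
  }
  where open Correspondence n m
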